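{- Let $(M,\le,1,\cdot)$ be a preordered monoid with monotone multiplication, $\mathbb{V}$ a cartesian category with distributive countable coproducts, and $p:\mathbb{P}\to\mathbb{V}$ a fibration for assertion logic (so $\mathbb{P}$ has finite products $\dot1,\dot\times$ strictly preserved by $p$). Let $(T,\eta,\mu,\mathrm{st})$ be a strong monad on $\mathbb{V}$ and $\dot T$ an $M$-graded lifting of $T$ along $p$. Let $(\mathbb{V},1,\times,\mathbb{V}_T,I,\ast)$ be the Kleisli Freyd category ($If=\eta\circ f$, $f\ast g=\mathrm{st}\circ(f\times g)$) and $(\mathbb{P},\dot1,\dot\times,\mathbb{P}_{\dot T},J,\circledast)$ the Kleisli $M$-graded Freyd category of $\dot T$ ($Jf=\dot\eta\circ f$, $f\circledast g=\dot{\mathrm{st}}\circ(f\dot\times g)$). Define $q_{\psi,\phi,m}:\mathbb{P}_{\dot T}(\psi,\phi)(m)=\mathbb{P}(\psi,\dot T_m\phi)\to\mathbb{V}(p\psi,Tp\phi)=\mathbb{V}_T(p\psi,p\phi)$ by $q(f)=pf$. Then $(\mathbb{P},\dot1,\dot\times,\mathbb{P}_{\dot T},J,\circledast)$ is an $M$-graded Freyd category with homogeneous countable coproducts and, together with $q$, is a logical structure with respect to $(\mathbb{V},1,\times,\mathbb{V}_T,I,\ast)$ and $p$.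
   Context: Fibration for assertion logic: a functor $p:\mathbb{P}\to\mathbb{V}$ whose fibres $\mathbb{P}_X$ (objects over $X$, morphisms over $\mathrm{id}_X$) are posets, with cartesian liftings giving reindexing maps $f^*$, such that each fibre is a distributive lattice with finite meets and countable joins (bottom $\bot_X$), each $f^*$ preserves them, and there are left adjoints $\mathrm{Eq}_{X,Y}\dashv c_{X,Y}^*$ (for $c_{X,Y}=\langle\pi_1,\pi_2,\pi_2\rangle$) and $\exists_{X,Y}\dashv\pi_1^*$ (for $\pi_1:X\times Y\to X$) satisfying Beck–Chevalley and Frobenius. An $M$-graded category has homsets $\mathcal{C}(I,J)(m)$, order-functorial upcasts ${\uparrow}_m^n$, identities of grade $1$ and composition from grades $m,n$ to $m\cdot n$, associative, unital, commuting with upcasts. Homogeneous coproduct of $\{X_i\}$: $Z$ with $\iota_i$ of grade $1$ such that precomposition $\mathcal{C}(Z,Y)(m)\to\prod_i\mathcal{C}(X_i,Y)(m)$ is bijective for all $m,Y$. An $M$-graded Freyd category $(\mathbb{V},1,\times,\mathcal{C},I,\ast)$: cartesian $\mathbb{V}$, $M$-graded $\mathcal{C}$ with same objects, $I:\mathbb{V}(V,W)\to\mathcal{C}(V,W)(1)$, $\ast:\mathbb{V}(V,W)\times\mathcal{C}(X,Y)(m)\to\mathcal{C}(V\times X,W\times Y)(m)$ with $I$ functorial, $I(f\times g)=f\ast Ig$, $\ast$ bifunctorial and commuting with upcasts, natural w.r.t. left unitor and associator. It has homogeneous countable coproducts if $\mathbb{V}$ has countable coproducts preserved by $V\times-$,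 $\mathcal{C}$ has homogeneous countable coproducts, $I$ sends countable coproducts to homogeneous coproducts, and $\mathrm{id}_V\ast-$ preserves homogeneous countable coproducts. (With trivial $M$: a Freyd category with countable coproducts.) $M$-graded lifting: a strong $M$-graded monad $(\dot T,\dot\eta,\dot\mu,\dot{\mathrm{st}})$ on $\mathbb{P}$ (functors $\dot T_m$, natural $\dot T(m\le m')$, $\dot\eta:\mathrm{Id}\to\dot T_1$, $\dot\mu_{m,m'}:\dot T_m\dot T_{m'}\to\dot T_{mm'}$, strength $\dot{\mathrm{st}}:\psi\dot\times\dot T_m\phi\to\dot T_m(\psi\dot\times\phi)$, satisfying graded monad and strength laws) with $p\circ\dot T_m=T\circ p$, $p(\dot\eta_\psi)=\eta_{p\psi}$, $p(\dot\mu_{m,m',\psi})=\mu_{p\psi}$, $p(\dot T(m\le m')_\psi)=\mathrm{id}$, $p(\dot{\mathrm{st}}_{\psi,\phi,m})=\mathrm{st}_{p\psi,p\phi}$. Its Kleisli graded category: $\mathbb{P}_{\dot T}(\psi,\phi)(m)=\mathbb{P}(\psi,\dot T_m\phi)$, identity $\dot\eta$, composition $\dot\mu\circ\dot T_mg\circ f$, upcast via $\dot T(m\le n)$. Logical structure w.r.t. a Freyd category $(\mathbb{V},1,\times,\mathcal{C},I,\ast)$ with countable coproducts and $p$: an $M$-graded Freyd category $(\mathbb{P},\dot1,\dot\times,\mathcal{E},\dot I,\circledast)$ with homogeneous countable coproducts and functions $q_{\psi,\phi,m}:\mathcal{E}(\psi,\phi)(m)\to\mathcal{C}(p\psi,p\phi)$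 with $q(\mathrm{id})=\mathrm{id}$, $q(g\circ f)=qg\circ qf$, $q({\uparrow}_m^n f)=qf$, $q(\dot If)=I(pf)$, $q(f\circledast g)=pf\ast qg$, such that $q$ sends homogeneous countable coproducts to countable coproducts, and $q_{\bot_X,\phi,m}:\mathcal{E}(\bot_X,\phi)(m)\to\mathcal{C}(X,p\phi)$ is a bijection for all $X,\phi,m$. -}

module Defs where

open import Level using (Level; _⊔_) renaming (suc to lsuc; zero to lzero)
open import Relation.Binary.PropositionalEquality using (_≡_; refl; sym; trans; cong; subst; subst₂)
open import Data.Product using (Σ; _×_; _,_; proj₁; proj₂)
open import Data.Nat using (ℕ)
open import Function.Bundles using (_↣_)
open import Function.Definitions using (Bijective)

-- Grades are compared with propositional equality (monoid laws hold
-- on the nose) and ≤ is proof-irrelevant (a preorder, i.e. a thin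
-- category).

record PreorderedMonoid : Set₁ where
  infixl 7 _·_
  infix 4 _≤_
  field
    Carrier    : Set
    _≤_        : Carrier → Carrier → Set
    ≤-irrelevant : ∀ {m n} (a b : m ≤ n) → a ≡ b
    ≤-refl     : ∀ {m} → m ≤ m
    ≤-trans    : ∀ {m n k} → m ≤ n → n ≤ k → m ≤ k
    _·_        : Carrier → Carrier → Carrier
    ε          : Carrier
    ·-assoc    : ∀ m n k → (m · n) · k ≡ m · (n · k)
    ·-identityˡ : ∀ m → ε · m ≡ m
    ·-identityʳ : ∀ m → m · ε ≡ m
    ·-mono     : ∀ {m m' n n'} → m ≤ m' → n ≤ n' → m · n ≤ m' · n'

record Category (o ℓ : Level) : Set (lsuc (o ⊔ ℓ)) where
  infixr 9 _∘_
  infix 4 _⇒_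
  field
    Obj       : Set o
    _⇒_       : Obj → Obj → Set ℓ
    id        : ∀ {A} → A ⇒ A
    _∘_       : ∀ {A B C} → B ⇒ C → A ⇒ B → A ⇒ C
    identityˡ : ∀ {A B} (f : A ⇒ B) → id ∘ f ≡ f
    identityʳ : ∀ {A B} (f : A ⇒ B) → f ∘ id ≡ f
    assoc     : ∀ {A B C D} (h : C ⇒ D) (g : B ⇒ C) (f : A ⇒ B) →
                (h ∘ g) ∘ f ≡ h ∘ (g ∘ f)

  cast : ∀ {A A' B B'} → A ≡ A' → B ≡ B' → A ⇒ B → A' ⇒ B'
  cast eA eB f = subst₂ _⇒_ eA eB f

record Functor {o ℓ o' ℓ'} (C : Category o ℓ) (D : Category o' ℓ')
       : Set (o ⊔ ℓ ⊔ o' ⊔ ℓ') where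
  private
    module C = Category C
    module D = Category D
  field
    F₀ : C.Obj → D.Obj
    F₁ : ∀ {A B} → A C.⇒ B → F₀ A D.⇒ F₀ B
    identity     : ∀ {A} → F₁ (C.id {A}) ≡ D.id
    homomorphism : ∀ {A B C'} (g : B C.⇒ C') (f : A C.⇒ B) →
                   F₁ (g C.∘ f) ≡ F₁ g D.∘ F₁ f

record Cartesian {o ℓ} (C : Category o ℓ) : Set (o ⊔ ℓ) where
  open Category C
  infixr 7 _⊗₀_
  infixr 7 _⊗₁_
  field
    𝟙        : Obj
    !        : ∀ {A} → A ⇒ 𝟙
    !-unique : ∀ {A} (f : A ⇒ 𝟙) → f ≡ !
    _⊗₀_     : Obj → Obj → Obj
    π₁       : ∀ {A B} → A ⊗₀ B ⇒ A
    π₂       : ∀ {A B} → A ⊗₀ B ⇒ B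
    ⟨_,_⟩    : ∀ {A B X} → X ⇒ A → X ⇒ B → X ⇒ A ⊗₀ B
    π₁-β     : ∀ {A B X} (f : X ⇒ A) (g : X ⇒ B) → π₁ ∘ ⟨ f , g ⟩ ≡ f
    π₂-β     : ∀ {A B X} (f : X ⇒ A) (g : X ⇒ B) → π₂ ∘ ⟨ f , g ⟩ ≡ g
    ⟨⟩-unique : ∀ {A B X} (f : X ⇒ A) (g : X ⇒ B) (h : X ⇒ A ⊗₀ B) →
                π₁ ∘ h ≡ f → π₂ ∘ h ≡ g → h ≡ ⟨ f , g ⟩

  _⊗₁_ : ∀ {A B C D} → A ⇒ B → C ⇒ D → A ⊗₀ C ⇒ B ⊗₀ D
  f ⊗₁ g = ⟨ f ∘ π₁ , g ∘ π₂ ⟩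

  λ⇒ : ∀ {A} → 𝟙 ⊗₀ A ⇒ A
  λ⇒ = π₂

  α⇒ : ∀ {A B C} → (A ⊗₀ B) ⊗₀ C ⇒ A ⊗₀ (B ⊗₀ C)
  α⇒ = ⟨ π₁ ∘ π₁ , ⟨ π₂ ∘ π₁ , π₂ ⟩ ⟩

Countable : Set → Set
Countable I = I ↣ ℕ

-- Coproduct cocone for raw hom-data: precomposition with the injections
--   Hom(Z,Y) → Π_i Hom(X_i,Y)  is a bijection (for every Y).
record IsCoproduct {o ℓ} {Obj : Set o} (Hom : Obj → Obj → Set ℓ)
         (comp : ∀ {A B C} → Hom B C → Hom A B → Hom A C)
         {I : Set} (X : I → Obj) (Z : Obj) (ι : ∀ i → Hom (X i) Z)
         : Set (o ⊔ ℓ) where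
  field
    copair        : ∀ {Y} → (∀ i → Hom (X i) Y) → Hom Z Y
    copair-β      : ∀ {Y} (f : ∀ i → Hom (X i) Y) i → comp (copair f) (ι i) ≡ f i
    copair-unique : ∀ {Y} (h h' : Hom Z Y) →
                    (∀ i → comp h (ι i) ≡ comp h' (ι i)) → h ≡ h'

record DistributiveCountableCoproducts {o ℓ} (C : Category o ℓ) (CC : Cartesian C)
       : Set (lsuc lzero ⊔ o ⊔ ℓ) where
  open Category C
  open Cartesian CC
  field
    ∐     : ∀ {I : Set} → Countable I → (I → Obj) → Obj
    ι     : ∀ {I : Set} (c : Countable I) (X : I → Obj) (i : I) → X i ⇒ ∐ c X
    isCoproduct : ∀ {I : Set} (c : Countable I) (X : I → Obj) →
                  IsCoproduct _⇒_ _∘_ X (∐ c X) (ι c X)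
    distributive : ∀ {I : Set} (c : Countable I) (X : I → Obj) (V : Obj) →
                  IsCoproduct _⇒_ _∘_ (λ i → V ⊗₀ X i) (V ⊗₀ ∐ c X)
                              (λ i → id ⊗₁ ι c X i)

record GradedCategoryData (M : PreorderedMonoid) {o} (Obj : Set o) (ℓ : Level)
       : Set (o ⊔ lsuc ℓ) where
  open PreorderedMonoid M
  field
    Hom  : Obj → Obj → Carrier → Set ℓ
    up   : ∀ {A B m n} → m ≤ n → Hom A B m → Hom A B n
    id   : ∀ {A} → Hom A A ε
    comp : ∀ {A B C m n} → Hom B C n → Hom A B m → Hom A C (m · n)

module _ {M : PreorderedMonoid} {o} {Obj : Set o} {ℓ} (G : GradedCategoryData M Obj ℓ) where
  open PreorderedMonoid M
  open GradedCategoryData G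

  record IsGradedCategory : Set (o ⊔ ℓ) where
    field
      up-refl  : ∀ {A B m} (f : Hom A B m) → up ≤-refl f ≡ f
      up-trans : ∀ {A B m n k} (a : m ≤ n) (b : n ≤ k) (f : Hom A B m) →
                 up b (up a f) ≡ up (≤-trans a b) f
      identityˡ : ∀ {A B m} (f : Hom A B m) →
                  subst (Hom A B) (·-identityʳ m) (comp id f) ≡ f
      identityʳ : ∀ {A B m} (f : Hom A B m) →
                  subst (Hom A B) (·-identityˡ m) (comp f id) ≡ f
      assoc : ∀ {A B C D m n k} (h : Hom C D k) (g : Hom B C n) (f : Hom A B m) →
              subst (Hom A D) (·-assoc m n k) (comp h (comp g f)) ≡ comp (comp h g) f
      comp-up : ∀ {A B C m m' n n'} (a : m ≤ m') (b : n ≤ n')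
                (g : Hom B C n) (f : Hom A B m) →
                comp (up b g) (up a f) ≡ up (·-mono a b) (comp g f)

  record IsHomogeneousCoproduct {I : Set} (X : I → Obj) (Z : Obj)
           (ι : ∀ i → Hom (X i) Z ε) : Set (o ⊔ ℓ) where
    field
      copair        : ∀ {Y m} → (∀ i → Hom (X i) Y m) → Hom Z Y m
      copair-β      : ∀ {Y m} (f : ∀ i → Hom (X i) Y m) i →
                      subst (Hom (X i) Y) (·-identityˡ m) (comp (copair f) (ι i)) ≡ f i
      copair-unique : ∀ {Y m} (h h' : Hom Z Y m) →
                      (∀ i → comp h (ι i) ≡ comp h' (ι i)) → h ≡ h'

record GradedFreydData (M : PreorderedMonoid) {o ℓ} (V : Category o ℓ) (cart : Cartesian V)
       (ℓ' : Level) : Set (o ⊔ ℓ ⊔ lsuc ℓ') where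
  open PreorderedMonoid M
  open Category V
  open Cartesian cart
  field
    𝓒    : GradedCategoryData M Obj ℓ'
  open GradedCategoryData 𝓒
  field
    I   : ∀ {A B} → A ⇒ B → Hom A B ε
    _⊛_ : ∀ {A B X Y m} → A ⇒ B → Hom X Y m → Hom (A ⊗₀ X) (B ⊗₀ Y) m

module _ {M : PreorderedMonoid} {o ℓ} {V : Category o ℓ} {cart : Cartesian V} {ℓ'}
         (F : GradedFreydData M V cart ℓ') where
  open PreorderedMonoid M
  open Category V
  open GradedFreydData F
  open Cartesian cart
  open GradedCategoryData 𝓒 renaming (id to idC)

  record IsGradedFreyd : Set (o ⊔ ℓ ⊔ ℓ') where
    field
      isGradedCategory : IsGradedCategory 𝓒
      I-identity : ∀ {A} → I (id {A}) ≡ idC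
      I-homomorphism : ∀ {A B C} (g : B ⇒ C) (f : A ⇒ B) →
                       subst (Hom A C) (·-identityˡ ε) (comp (I g) (I f)) ≡ I (g ∘ f)
      I-⊗ : ∀ {A B C D} (f : A ⇒ B) (g : C ⇒ D) → I (f ⊗₁ g) ≡ f ⊛ I g
      ⊛-identity : ∀ {A X} → (id {A}) ⊛ (idC {X}) ≡ idC
      ⊛-homomorphism : ∀ {A B C X Y Z m n} (f' : B ⇒ C) (f : A ⇒ B)
                       (g' : Hom Y Z n) (g : Hom X Y m) →
                       (f' ∘ f) ⊛ comp g' g ≡ comp (f' ⊛ g') (f ⊛ g)
      ⊛-up : ∀ {A B X Y m n} (a : m ≤ n) (f : A ⇒ B) (g : Hom X Y m) →
             f ⊛ up a g ≡ up a (f ⊛ g)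
      unitor-natural : ∀ {X Y m} (g : Hom X Y m) →
             subst (Hom (𝟙 ⊗₀ X) Y) (·-identityʳ m) (comp (I λ⇒) (id ⊛ g))
             ≡ subst (Hom (𝟙 ⊗₀ X) Y) (·-identityˡ m) (comp g (I λ⇒))
      associator-natural : ∀ {A A' B B' X Y m} (f : A ⇒ A') (g : B ⇒ B') (h : Hom X Y m) →
             subst (Hom ((A ⊗₀ B) ⊗₀ X) (A' ⊗₀ (B' ⊗₀ Y))) (·-identityʳ m)
                   (comp (I α⇒) ((f ⊗₁ g) ⊛ h))
             ≡ subst (Hom ((A ⊗₀ B) ⊗₀ X) (A' ⊗₀ (B' ⊗₀ Y))) (·-identityˡ m)
                   (comp (f ⊛ (g ⊛ h)) (I α⇒))

  record HasHomogeneousCountableCoproducts : Set (lsuc lzero ⊔ o ⊔ ℓ ⊔ ℓ') where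
    field
      base-coproducts : DistributiveCountableCoproducts V cart
      homogeneous-coproducts : ∀ {K : Set} → Countable K → (X : K → Obj) →
        Σ Obj λ Z → Σ (∀ i → Hom (X i) Z ε) λ ι → IsHomogeneousCoproduct 𝓒 X Z ι
      I-preserves : ∀ {K : Set} → Countable K → (X : K → Obj) (Z : Obj)
        (ι : ∀ i → X i ⇒ Z) → IsCoproduct _⇒_ _∘_ X Z ι →
        IsHomogeneousCoproduct 𝓒 X Z (λ i → I (ι i))
      id⊛-preserves : ∀ {K : Set} → Countable K → (X : K → Obj) (Z : Obj)
        (ι : ∀ i → Hom (X i) Z ε) → IsHomogeneousCoproduct 𝓒 X Z ι →
        (A : Obj) → IsHomogeneousCoproduct 𝓒 (λ i → A ⊗₀ X i) (A ⊗₀ Z) (λ i → id ⊛ ι i)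

module Fibred {o ℓ o' ℓ'} {V : Category o ℓ} {P : Category o' ℓ'} (p : Functor P V) where
  private
    module V = Category V
    module P = Category P
  open Functor p

  Fibre : V.Obj → Set (o ⊔ o')
  Fibre X = Σ P.Obj λ ψ → F₀ ψ ≡ X

  infix 4 _≤_ _≈_
  _≤_ : ∀ {X} → Fibre X → Fibre X → Set (ℓ ⊔ ℓ')
  (ψ , e) ≤ (φ , e') = Σ (ψ P.⇒ φ) λ f → V.cast e e' (F₁ f) ≡ V.id

  _≈_ : ∀ {X} → Fibre X → Fibre X → Set (ℓ ⊔ ℓ')
  ψ ≈ φ = (ψ ≤ φ) × (φ ≤ ψ)

  IsCartesian : ∀ {ψ φ} → ψ P.⇒ φ → Set (o' ⊔ ℓ ⊔ ℓ')
  IsCartesian {ψ} {φ} f =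
    ∀ {χ} (g : χ P.⇒ φ) (v : F₀ χ V.⇒ F₀ ψ) → F₁ f V.∘ v ≡ F₁ g →
      Σ (χ P.⇒ ψ) (λ h → (f P.∘ h ≡ g) × (F₁ h ≡ v))
      × (∀ (h h' : χ P.⇒ ψ) → f P.∘ h ≡ g → F₁ h ≡ v →
                             f P.∘ h' ≡ g → F₁ h' ≡ v → h ≡ h')

  CartesianLift : ∀ {X Y} → X V.⇒ Y → Fibre Y → Set (o ⊔ o' ⊔ ℓ ⊔ ℓ')
  CartesianLift {X} u (φ , e') =
    Σ (Fibre X) λ { (ψ , e) → Σ (ψ P.⇒ φ) λ f → (V.cast e e' (F₁ f) ≡ u) × IsCartesian f }

  record FibrationForAssertionLogic (VC : Cartesian V)
         : Set (lsuc lzero ⊔ o ⊔ o' ⊔ ℓ ⊔ ℓ') where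
    open Cartesian VC
    field
      lift : ∀ {X Y} (u : X V.⇒ Y) (φ : Fibre Y) → CartesianLift u φ

    reindex : ∀ {X Y} → X V.⇒ Y → Fibre Y → Fibre X
    reindex u φ = proj₁ (lift u φ)

    c : ∀ {X Y} → X ⊗₀ Y V.⇒ X ⊗₀ (Y ⊗₀ Y)
    c = ⟨ π₁ , ⟨ π₂ , π₂ ⟩ ⟩

    field
      thin    : ∀ {X} {ψ φ : Fibre X} (a b : ψ ≤ φ) → proj₁ a ≡ proj₁ b
      antisym : ∀ {X} {ψ φ : Fibre X} → ψ ≤ φ → φ ≤ ψ → proj₁ ψ ≡ proj₁ φ
      ⊤     : ∀ X → Fibre X
      _∧_   : ∀ {X} → Fibre X → Fibre X → Fibre X
      ⊤-max : ∀ {X} (ψ : Fibre X) → ψ ≤ ⊤ X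
      ∧-lb₁ : ∀ {X} (ψ φ : Fibre X) → ψ ∧ φ ≤ ψ
      ∧-lb₂ : ∀ {X} (ψ φ : Fibre X) → ψ ∧ φ ≤ φ
      ∧-glb : ∀ {X} {χ ψ φ : Fibre X} → χ ≤ ψ → χ ≤ φ → χ ≤ ψ ∧ φ
      ⋁     : ∀ {X} {K : Set} → Countable K → (K → Fibre X) → Fibre X
      ⋁-ub  : ∀ {X} {K : Set} (k : Countable K) (φ : K → Fibre X) i → φ i ≤ ⋁ k φ
      ⋁-lub : ∀ {X} {K : Set} (k : Countable K) (φ : K → Fibre X) (χ : Fibre X) →
              (∀ i → φ i ≤ χ) → ⋁ k φ ≤ χ
      ⊥     : ∀ X → Fibre X
      ⊥-min : ∀ {X} (ψ : Fibre X) → ⊥ X ≤ ψ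
      distributive : ∀ {X} {K : Set} (k : Countable K) (ψ : Fibre X) (φ : K → Fibre X) →
                     ψ ∧ ⋁ k φ ≤ ⋁ k (λ i → ψ ∧ φ i)
      reindex-⊤ : ∀ {X Y} (u : X V.⇒ Y) → reindex u (⊤ Y) ≈ ⊤ X
      reindex-∧ : ∀ {X Y} (u : X V.⇒ Y) (ψ φ : Fibre Y) →
                  reindex u (ψ ∧ φ) ≈ reindex u ψ ∧ reindex u φ
      reindex-⋁ : ∀ {X Y} {K : Set} (u : X V.⇒ Y) (k : Countable K) (φ : K → Fibre Y) →
                  reindex u (⋁ k φ) ≈ ⋁ k (λ i → reindex u (φ i))
      reindex-⊥ : ∀ {X Y} (u : X V.⇒ Y) → reindex u (⊥ Y) ≈ ⊥ X
      Eq      : ∀ {X Y} → Fibre (X ⊗₀ Y) → Fibre (X ⊗₀ (Y ⊗₀ Y))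
      Eq-adj₁ : ∀ {X Y} (ψ : Fibre (X ⊗₀ Y)) (φ : Fibre (X ⊗₀ (Y ⊗₀ Y))) →
                Eq ψ ≤ φ → ψ ≤ reindex c φ
      Eq-adj₂ : ∀ {X Y} (ψ : Fibre (X ⊗₀ Y)) (φ : Fibre (X ⊗₀ (Y ⊗₀ Y))) →
                ψ ≤ reindex c φ → Eq ψ ≤ φ
      Eq-BC   : ∀ {X X' Y} (f : X' V.⇒ X) (ψ : Fibre (X ⊗₀ Y)) →
                reindex (f ⊗₁ (V.id ⊗₁ V.id)) (Eq ψ) ≈ Eq (reindex (f ⊗₁ V.id) ψ)
      Eq-Frobenius : ∀ {X Y} (ψ : Fibre (X ⊗₀ Y)) (φ : Fibre (X ⊗₀ (Y ⊗₀ Y))) →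
                Eq (ψ ∧ reindex c φ) ≈ Eq ψ ∧ φ
      ∃       : ∀ {X Y} → Fibre (X ⊗₀ Y) → Fibre X
      ∃-adj₁  : ∀ {X Y} (ψ : Fibre (X ⊗₀ Y)) (φ : Fibre X) → ∃ ψ ≤ φ → ψ ≤ reindex π₁ φ
      ∃-adj₂  : ∀ {X Y} (ψ : Fibre (X ⊗₀ Y)) (φ : Fibre X) → ψ ≤ reindex π₁ φ → ∃ ψ ≤ φ
      ∃-BC    : ∀ {X X' Y} (f : X' V.⇒ X) (ψ : Fibre (X ⊗₀ Y)) →
                reindex f (∃ ψ) ≈ ∃ (reindex (f ⊗₁ V.id) ψ)
      ∃-Frobenius : ∀ {X Y} (ψ : Fibre (X ⊗₀ Y)) (φ : Fibre X) →
                ∃ (ψ ∧ reindex π₁ φ) ≈ ∃ ψ ∧ φ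

record StrictlyPreservesProducts {o ℓ o' ℓ'} {V : Category o ℓ} {P : Category o' ℓ'}
         (VC : Cartesian V) (PC : Cartesian P) (p : Functor P V) : Set (o ⊔ o' ⊔ ℓ) where
  private
    module V = Category V
    module VC = Cartesian VC
    module PC = Cartesian PC
  open Functor p
  field
    𝟙-obj : F₀ PC.𝟙 ≡ VC.𝟙
    ⊗-obj : ∀ ψ φ → F₀ (ψ PC.⊗₀ φ) ≡ F₀ ψ VC.⊗₀ F₀ φ
    π₁-pres : ∀ {ψ φ} → V.cast (⊗-obj ψ φ) refl (F₁ (PC.π₁ {ψ} {φ})) ≡ VC.π₁
    π₂-pres : ∀ {ψ φ} → V.cast (⊗-obj ψ φ) refl (F₁ (PC.π₂ {ψ} {φ})) ≡ VC.π₂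

record StrongMonad {o ℓ} (V : Category o ℓ) (VC : Cartesian V) : Set (o ⊔ ℓ) where
  open Category V
  open Cartesian VC
  field
    T₀ : Obj → Obj
    T₁ : ∀ {A B} → A ⇒ B → T₀ A ⇒ T₀ B
    T-identity     : ∀ {A} → T₁ (id {A}) ≡ id
    T-homomorphism : ∀ {A B C} (g : B ⇒ C) (f : A ⇒ B) → T₁ (g ∘ f) ≡ T₁ g ∘ T₁ f
    η  : ∀ {A} → A ⇒ T₀ A
    μ  : ∀ {A} → T₀ (T₀ A) ⇒ T₀ A
    η-natural : ∀ {A B} (f : A ⇒ B) → T₁ f ∘ η ≡ η ∘ f
    μ-natural : ∀ {A B} (f : A ⇒ B) → T₁ f ∘ μ ≡ μ ∘ T₁ (T₁ f)
    identityˡ : ∀ {A} → μ ∘ η {T₀ A} ≡ id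
    identityʳ : ∀ {A} → μ ∘ T₁ (η {A}) ≡ id
    assoc     : ∀ {A} → μ ∘ T₁ (μ {A}) ≡ μ ∘ μ
    st : ∀ {A B} → A ⊗₀ T₀ B ⇒ T₀ (A ⊗₀ B)
    st-natural : ∀ {A A' B B'} (f : A ⇒ A') (g : B ⇒ B') →
                 st ∘ (f ⊗₁ T₁ g) ≡ T₁ (f ⊗₁ g) ∘ st
    st-unitor  : ∀ {A} → T₁ λ⇒ ∘ st {𝟙} {A} ≡ λ⇒
    st-assoc   : ∀ {A B C} → T₁ α⇒ ∘ st {A ⊗₀ B} {C} ≡ st ∘ (id ⊗₁ st) ∘ α⇒
    st-η       : ∀ {A B} → st ∘ (id ⊗₁ η) ≡ η {A ⊗₀ B}
    st-μ       : ∀ {A B} → st ∘ (id ⊗₁ μ) ≡ μ ∘ T₁ st ∘ st {A} {T₀ B}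

record GradedLifting (M : PreorderedMonoid) {o ℓ o' ℓ'}
         {V : Category o ℓ} {P : Category o' ℓ'}
         {VC : Cartesian V} {PC : Cartesian P} {p : Functor P V}
         (pres : StrictlyPreservesProducts VC PC p) (T : StrongMonad V VC)
         : Set (o ⊔ o' ⊔ ℓ' ⊔ ℓ) where
  open PreorderedMonoid M
  private
    module V = Category V
    module VC = Cartesian VC
  open Category P
  open Cartesian PC
  open Functor p
  open StrongMonad T using (T₀; T₁; η; μ; st)
  open StrictlyPreservesProducts pres
  field
    Ṫ₀ : Carrier → Obj → Obj
    Ṫ₁ : ∀ m {ψ φ} → ψ ⇒ φ → Ṫ₀ m ψ ⇒ Ṫ₀ m φ
    Ṫ-identity     : ∀ m {ψ} → Ṫ₁ m (id {ψ}) ≡ id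
    Ṫ-homomorphism : ∀ m {ψ φ χ} (g : φ ⇒ χ) (f : ψ ⇒ φ) → Ṫ₁ m (g ∘ f) ≡ Ṫ₁ m g ∘ Ṫ₁ m f
    Ṫ≤ : ∀ {m n} → m ≤ n → ∀ {ψ} → Ṫ₀ m ψ ⇒ Ṫ₀ n ψ
    Ṫ≤-natural : ∀ {m n} (a : m ≤ n) {ψ φ} (f : ψ ⇒ φ) → Ṫ₁ n f ∘ Ṫ≤ a ≡ Ṫ≤ a ∘ Ṫ₁ m f
    Ṫ≤-refl  : ∀ {m ψ} → Ṫ≤ (≤-refl {m}) {ψ} ≡ id
    Ṫ≤-trans : ∀ {m n k} (a : m ≤ n) (b : n ≤ k) {ψ} → Ṫ≤ (≤-trans a b) {ψ} ≡ Ṫ≤ b ∘ Ṫ≤ a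
    η̇ : ∀ {ψ} → ψ ⇒ Ṫ₀ ε ψ
    μ̇ : ∀ {m n ψ} → Ṫ₀ m (Ṫ₀ n ψ) ⇒ Ṫ₀ (m · n) ψ
    η̇-natural : ∀ {ψ φ} (f : ψ ⇒ φ) → Ṫ₁ ε f ∘ η̇ ≡ η̇ ∘ f
    μ̇-natural : ∀ {m n ψ φ} (f : ψ ⇒ φ) → Ṫ₁ (m · n) f ∘ μ̇ ≡ μ̇ ∘ Ṫ₁ m (Ṫ₁ n f)
    μ̇-Ṫ≤ : ∀ {m m' n n'} (a : m ≤ m') (b : n ≤ n') {ψ} →
           Ṫ≤ (·-mono a b) ∘ μ̇ {m} {n} {ψ} ≡ μ̇ ∘ Ṫ≤ a ∘ Ṫ₁ m (Ṫ≤ b)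
    identityˡ : ∀ {m ψ} →
           subst (λ k → Ṫ₀ m ψ ⇒ Ṫ₀ k ψ) (·-identityˡ m) (μ̇ {ε} {m} ∘ η̇) ≡ id
    identityʳ : ∀ {m ψ} →
           subst (λ k → Ṫ₀ m ψ ⇒ Ṫ₀ k ψ) (·-identityʳ m) (μ̇ {m} {ε} ∘ Ṫ₁ m η̇) ≡ id
    assoc : ∀ {m n k ψ} →
           subst (λ j → Ṫ₀ m (Ṫ₀ n (Ṫ₀ k ψ)) ⇒ Ṫ₀ j ψ) (·-assoc m n k)
                 (μ̇ {m · n} {k} ∘ μ̇ {m} {n})
           ≡ μ̇ {m} {n · k} ∘ Ṫ₁ m μ̇
    ṡt : ∀ {m ψ φ} → ψ ⊗₀ Ṫ₀ m φ ⇒ Ṫ₀ m (ψ ⊗₀ φ)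
    ṡt-natural : ∀ {m ψ ψ' φ φ'} (f : ψ ⇒ ψ') (g : φ ⇒ φ') →
                 ṡt ∘ (f ⊗₁ Ṫ₁ m g) ≡ Ṫ₁ m (f ⊗₁ g) ∘ ṡt
    ṡt-Ṫ≤     : ∀ {m n} (a : m ≤ n) {ψ φ} → Ṫ≤ a ∘ ṡt {m} {ψ} {φ} ≡ ṡt ∘ (id ⊗₁ Ṫ≤ a)
    ṡt-unitor  : ∀ {m φ} → Ṫ₁ m λ⇒ ∘ ṡt {m} {𝟙} {φ} ≡ λ⇒
    ṡt-assoc   : ∀ {m ψ φ χ} → Ṫ₁ m α⇒ ∘ ṡt {m} {ψ ⊗₀ φ} {χ} ≡ ṡt ∘ (id ⊗₁ ṡt) ∘ α⇒
    ṡt-η       : ∀ {ψ φ} → ṡt ∘ (id ⊗₁ η̇) ≡ η̇ {ψ ⊗₀ φ}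
    ṡt-μ       : ∀ {m n ψ φ} → ṡt ∘ (id ⊗₁ μ̇ {m} {n}) ≡ μ̇ ∘ Ṫ₁ m ṡt ∘ ṡt {m} {ψ} {Ṫ₀ n φ}
    lift-obj : ∀ m ψ → F₀ (Ṫ₀ m ψ) ≡ T₀ (F₀ ψ)
    lift-hom : ∀ m {ψ φ} (f : ψ ⇒ φ) →
               V.cast (lift-obj m ψ) (lift-obj m φ) (F₁ (Ṫ₁ m f)) ≡ T₁ (F₁ f)
    lift-η : ∀ {ψ} → V.cast refl (lift-obj ε ψ) (F₁ (η̇ {ψ})) ≡ η
    lift-μ : ∀ {m n ψ} →
             V.cast (trans (lift-obj m (Ṫ₀ n ψ)) (cong T₀ (lift-obj n ψ))) (lift-obj (m · n) ψ)
                    (F₁ (μ̇ {m} {n} {ψ})) ≡ μ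
    lift-≤ : ∀ {m n} (a : m ≤ n) {ψ} →
             V.cast (lift-obj m ψ) (lift-obj n ψ) (F₁ (Ṫ≤ a {ψ})) ≡ V.id
    lift-st : ∀ {m ψ φ} →
             V.cast (trans (⊗-obj ψ (Ṫ₀ m φ)) (cong (F₀ ψ VC.⊗₀_) (lift-obj m φ)))
                    (trans (lift-obj m (ψ ⊗₀ φ)) (cong T₀ (⊗-obj ψ φ)))
                    (F₁ (ṡt {m} {ψ} {φ})) ≡ st

record FreydData {o ℓ} (V : Category o ℓ) (VC : Cartesian V) (ℓ' : Level)
       : Set (o ⊔ ℓ ⊔ lsuc ℓ') where
  open Category V
  open Cartesian VC
  field
    Hom  : Obj → Obj → Set ℓ'
    idC  : ∀ {A} → Hom A A
    comp : ∀ {A B C} → Hom B C → Hom A B → Hom A C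
    I    : ∀ {A B} → A ⇒ B → Hom A B
    _∗_  : ∀ {A B X Y} → A ⇒ B → Hom X Y → Hom (A ⊗₀ X) (B ⊗₀ Y)

module _ (M : PreorderedMonoid) {o ℓ o' ℓ' ℓc ℓe}
         {V : Category o ℓ} {P : Category o' ℓ'}
         {VC : Cartesian V} {PC : Cartesian P} {p : Functor P V}
         (fib : Fibred.FibrationForAssertionLogic p VC)
         (pres : StrictlyPreservesProducts VC PC p)
         (𝐂 : FreydData V VC ℓc)
         (𝐄 : GradedFreydData M P PC ℓe) where
  open PreorderedMonoid M
  private
    module V = Category V
    module P = Category P
    module 𝐂 = FreydData 𝐂
  open Functor p
  open GradedFreydData 𝐄
  open GradedCategoryData 𝓒
  open StrictlyPreservesProducts pres
  open Fibred.FibrationForAssertionLogic fib using (⊥)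

  record IsLogicalStructure
         (q : ∀ {ψ φ m} → Hom ψ φ m → 𝐂.Hom (F₀ ψ) (F₀ φ))
         : Set (lsuc lzero ⊔ o ⊔ ℓ ⊔ o' ⊔ ℓ' ⊔ ℓc ⊔ ℓe) where
    field
      isGradedFreyd : IsGradedFreyd 𝐄
      hasHomogeneousCountableCoproducts : HasHomogeneousCountableCoproducts 𝐄
      q-id   : ∀ {ψ} → q (id {ψ}) ≡ 𝐂.idC
      q-comp : ∀ {ψ φ χ m n} (g : Hom φ χ n) (f : Hom ψ φ m) →
               q (comp g f) ≡ 𝐂.comp (q g) (q f)
      q-up   : ∀ {ψ φ m n} (a : m ≤ n) (f : Hom ψ φ m) → q (up a f) ≡ q f
      q-I    : ∀ {ψ φ} (f : ψ P.⇒ φ) → q (I f) ≡ 𝐂.I (F₁ f)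
      q-⊛    : ∀ {ψ φ χ ω m} (f : ψ P.⇒ φ) (g : Hom χ ω m) →
               subst₂ 𝐂.Hom (⊗-obj ψ χ) (⊗-obj φ ω) (q (f ⊛ g))
               ≡ F₁ f 𝐂.∗ q g
      q-coproducts : ∀ {K : Set} → Countable K → (X : K → P.Obj) (Z : P.Obj)
               (ι : ∀ i → Hom (X i) Z ε) → IsHomogeneousCoproduct 𝓒 X Z ι →
               IsCoproduct 𝐂.Hom 𝐂.comp (λ i → F₀ (X i)) (F₀ Z) (λ i → q (ι i))
      q-⊥-bijective : ∀ X φ m → Bijective _≡_ _≡_ (q {proj₁ (⊥ X)} {φ} {m})

KleisliFreyd : ∀ {o ℓ} {V : Category o ℓ} {VC : Cartesian V} →
               StrongMonad V VC → FreydData V VC ℓ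
KleisliFreyd {V = V} {VC} T = record
  { Hom  = λ A B → A ⇒ T₀ B
  ; idC  = η
  ; comp = λ g f → μ ∘ T₁ g ∘ f
  ; I    = λ f → η ∘ f
  ; _∗_  = λ f g → st ∘ (f ⊗₁ g)
  }
  where
    open Category V
    open Cartesian VC
    open StrongMonad T

module _ (M : PreorderedMonoid) {o ℓ o' ℓ'}
         {V : Category o ℓ} {P : Category o' ℓ'}
         {VC : Cartesian V} {PC : Cartesian P} {p : Functor P V}
         {pres : StrictlyPreservesProducts VC PC p} {T : StrongMonad V VC}
         (Ṫ : GradedLifting M pres T) where
  open PreorderedMonoid M
  private
    module V = Category V
  open Category P
  open Cartesian PC
  open Functor p
  open GradedLifting Ṫ

  KleisliGradedCategory : GradedCategoryData M Obj ℓ'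
  KleisliGradedCategory = record
    { Hom  = λ ψ φ m → ψ ⇒ Ṫ₀ m φ
    ; up   = λ a f → Ṫ≤ a ∘ f
    ; id   = η̇
    ; comp = λ {_} {_} {_} {m} g f → μ̇ ∘ Ṫ₁ m g ∘ f
    }

  KleisliGradedFreyd : GradedFreydData M P PC ℓ'
  KleisliGradedFreyd = record
    { 𝓒   = KleisliGradedCategory
    ; I   = λ f → η̇ ∘ f
    ; _⊛_ = λ f g → ṡt ∘ (f ⊗₁ g)
    }

  q : ∀ {ψ φ m} → ψ ⇒ Ṫ₀ m φ → Functor.F₀ p ψ V.⇒ StrongMonad.T₀ T (F₀ φ)
  q {ψ} {φ} {m} f = V.cast refl (lift-obj m φ) (F₁ f)

module Submission where

open import Level using (Level; _⊔_)
open import Relation.Binary.PropositionalEquality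
  using (_≡_; refl; sym; trans; cong; cong₂; subst; subst₂; module ≡-Reasoning)
open import Relation.Binary.PropositionalEquality.Properties using (subst-subst; subst-injective)
open import Axiom.UniquenessOfIdentityProofs.WithK using (uip)
open import Data.Product using (Σ; _,_; proj₁; proj₂)
open import Function.Definitions using (Bijective)
open import Defs

-- The Kleisli laws of ℙ_Ṫ are the graded monad and strength laws of Ṫ, and q is functorial because
-- p sends Ṫ, η̇, μ̇, ṡt and the upcasts to T, η, μ, st and identities.  For coproducts: p is faithful
-- (cartesian liftings and thin fibres), and the coproduct of a countable family X in ℙ is the
-- predicate ⋁ᵢ Σ_{ιᵢ} Xᵢ over ∐ᵢ p Xᵢ, where Σ_f ψ = ∃ x. (y = f x) ∧ ψ x is built from Eq and ∃;
-- Frobenius for ∃ and distributivity of the fibres make it distributive.  Every homogeneous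
-- coproduct of ℙ_Ṫ is a grade-1 retract of the J-image of such a coproduct, which transfers
-- preservation by id ⊛ - and by q.  Finally ⊥_X lies below every reindexed predicate, so the maps
-- out of ⊥_X are exactly the maps out of X.

module CastProperties {o ℓ} (C : Category o ℓ) where
  open Category C

  cast-∘ : ∀ {A A' B B' D D'} (a : A ≡ A') (b : B ≡ B') (d : D ≡ D')
           (g : B ⇒ D) (f : A ⇒ B) → cast a d (g ∘ f) ≡ cast b d g ∘ cast a b f
  cast-∘ refl refl refl g f = refl

  cast-cast : ∀ {A A' A'' B B' B''} (a₁ : A ≡ A') (b₁ : B ≡ B') (a₂ : A' ≡ A'') (b₂ : B' ≡ B'')
              (h : A ⇒ B) → cast a₂ b₂ (cast a₁ b₁ h) ≡ cast (trans a₁ a₂) (trans b₁ b₂) h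
  cast-cast refl refl refl refl h = refl

  cast-irrelevant : ∀ {A A' B B'} (a a' : A ≡ A') (b b' : B ≡ B') (h : A ⇒ B) →
                    cast a b h ≡ cast a' b' h
  cast-irrelevant a a' b b' h rewrite uip a a' | uip b b' = refl

  cast-trivial : ∀ {A B} (a : A ≡ A) (b : B ≡ B) (h : A ⇒ B) → cast a b h ≡ h
  cast-trivial a b = cast-irrelevant a refl b refl

  cast-sym-cast : ∀ {A A' B B'} (a : A ≡ A') (b : B ≡ B') (h : A ⇒ B) →
                  cast (sym a) (sym b) (cast a b h) ≡ h
  cast-sym-cast refl refl h = refl

  cast-id : ∀ {A A'} (a : A ≡ A') → cast a a id ≡ id
  cast-id refl = refl

  cast-move : ∀ {A A' B B'} (a : A ≡ A') (b : B ≡ B') {h : A ⇒ B} {k : A' ⇒ B'} →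
              cast a b h ≡ k → h ≡ cast (sym a) (sym b) k
  cast-move refl refl e = e

  cast-injectiveˡ : ∀ {A A' B} (e : A ≡ A') {x y : A ⇒ B} → cast e refl x ≡ cast e refl y → x ≡ y
  cast-injectiveˡ refl e = e

  cast-injectiveʳ : ∀ {A B B'} (e : B ≡ B') {x y : A ⇒ B} → cast refl e x ≡ cast refl e y → x ≡ y
  cast-injectiveʳ refl e = e

  IsCoproduct-cast : ∀ {I : Set} {X : I → Obj} {Z C} {j : ∀ i → X i ⇒ Z} {ι : ∀ i → X i ⇒ C}
    (e : Z ≡ C) → (∀ i → cast refl e (j i) ≡ ι i) → IsCoproduct _⇒_ _∘_ X C ι → IsCoproduct _⇒_ _∘_ X Z j
  IsCoproduct-cast refl j≡ι isC = record
    { copair        = copair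
    ; copair-β      = λ f i → trans (cong (copair f ∘_) (j≡ι i)) (copair-β f i)
    ; copair-unique = λ h h' eq → copair-unique h h' (λ i →
        trans (cong (h ∘_) (sym (j≡ι i))) (trans (eq i) (cong (h' ∘_) (j≡ι i))))
    }
    where open IsCoproduct isC

module CartesianProperties {o ℓ} (C : Category o ℓ) (CC : Cartesian C) where
  open Category C
  open Cartesian CC
  open ≡-Reasoning

  ⟨⟩-ext : ∀ {A B X} {h h' : X ⇒ A ⊗₀ B} → π₁ ∘ h ≡ π₁ ∘ h' → π₂ ∘ h ≡ π₂ ∘ h' → h ≡ h'
  ⟨⟩-ext {h = h} {h'} e₁ e₂ = trans (⟨⟩-unique _ _ h refl refl) (sym (⟨⟩-unique _ _ h' (sym e₁) (sym e₂)))

  π₁-β-∘ : ∀ {A B X Y} (a : X ⇒ A) (b : X ⇒ B) (h : Y ⇒ X) → π₁ ∘ (⟨ a , b ⟩ ∘ h) ≡ a ∘ h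
  π₁-β-∘ a b h = trans (sym (assoc _ _ _)) (cong (_∘ h) (π₁-β a b))

  π₂-β-∘ : ∀ {A B X Y} (a : X ⇒ A) (b : X ⇒ B) (h : Y ⇒ X) → π₂ ∘ (⟨ a , b ⟩ ∘ h) ≡ b ∘ h
  π₂-β-∘ a b h = trans (sym (assoc _ _ _)) (cong (_∘ h) (π₂-β a b))

  ⟨⟩∘ : ∀ {A B X Y} (f : X ⇒ A) (g : X ⇒ B) (h : Y ⇒ X) → ⟨ f , g ⟩ ∘ h ≡ ⟨ f ∘ h , g ∘ h ⟩
  ⟨⟩∘ f g h = ⟨⟩-unique _ _ _ (π₁-β-∘ f g h) (π₂-β-∘ f g h)

  ⟨π₁,π₂⟩ : ∀ {A B} → ⟨ π₁ , π₂ ⟩ ≡ id {A ⊗₀ B}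
  ⟨π₁,π₂⟩ = sym (⟨⟩-unique _ _ _ (identityʳ _) (identityʳ _))

  ⊗∘⟨⟩ : ∀ {A B A' B' X} (f : A ⇒ A') (g : B ⇒ B') (a : X ⇒ A) (b : X ⇒ B) →
         (f ⊗₁ g) ∘ ⟨ a , b ⟩ ≡ ⟨ f ∘ a , g ∘ b ⟩
  ⊗∘⟨⟩ f g a b = trans (⟨⟩∘ _ _ _) (cong₂ ⟨_,_⟩
    (trans (assoc _ _ _) (cong (f ∘_) (π₁-β a b)))
    (trans (assoc _ _ _) (cong (g ∘_) (π₂-β a b))))

  ⊗∘⊗ : ∀ {A B A' B' A'' B''} (f : A' ⇒ A'') (g : B' ⇒ B'') (f' : A ⇒ A') (g' : B ⇒ B') →
        (f ⊗₁ g) ∘ (f' ⊗₁ g') ≡ (f ∘ f') ⊗₁ (g ∘ g')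
  ⊗∘⊗ f g f' g' = trans (⊗∘⟨⟩ f g _ _) (cong₂ ⟨_,_⟩ (sym (assoc _ _ _)) (sym (assoc _ _ _)))

  id⊗id : ∀ {A B} → id {A} ⊗₁ id {B} ≡ id
  id⊗id = trans (cong₂ ⟨_,_⟩ (identityˡ _) (identityˡ _)) ⟨π₁,π₂⟩

  id⊗∘⊗ : ∀ {A A' B B' B''} (h : B' ⇒ B'') (f : A ⇒ A') (g : B ⇒ B') →
          (id ⊗₁ h) ∘ (f ⊗₁ g) ≡ f ⊗₁ (h ∘ g)
  id⊗∘⊗ h f g = trans (⊗∘⊗ id h f g) (cong (_⊗₁ (h ∘ g)) (identityˡ f))

  α⇒-natural : ∀ {A B D A' B' D'} (f : A ⇒ A') (g : B ⇒ B') (h : D ⇒ D') →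
               α⇒ ∘ ((f ⊗₁ g) ⊗₁ h) ≡ (f ⊗₁ (g ⊗₁ h)) ∘ α⇒
  α⇒-natural f g h = ⟨⟩-ext
    (begin
      π₁ ∘ (α⇒ ∘ ((f ⊗₁ g) ⊗₁ h))      ≡⟨ π₁-β-∘ _ _ _ ⟩
      (π₁ ∘ π₁) ∘ ((f ⊗₁ g) ⊗₁ h)      ≡⟨ assoc _ _ _ ⟩
      π₁ ∘ (π₁ ∘ ((f ⊗₁ g) ⊗₁ h))      ≡⟨ cong (π₁ ∘_) (π₁-β _ _) ⟩
      π₁ ∘ ((f ⊗₁ g) ∘ π₁)             ≡⟨ sym (assoc _ _ _) ⟩
      (π₁ ∘ (f ⊗₁ g)) ∘ π₁             ≡⟨ cong (_∘ π₁) (π₁-β _ _) ⟩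
      (f ∘ π₁) ∘ π₁                    ≡⟨ assoc _ _ _ ⟩
      f ∘ (π₁ ∘ π₁)                    ≡⟨ cong (f ∘_) (sym (π₁-β _ _)) ⟩
      f ∘ (π₁ ∘ α⇒)                    ≡⟨ sym (assoc _ _ _) ⟩
      (f ∘ π₁) ∘ α⇒                    ≡⟨ sym (π₁-β-∘ _ _ _) ⟩
      π₁ ∘ ((f ⊗₁ (g ⊗₁ h)) ∘ α⇒)      ∎)
    (begin
      π₂ ∘ (α⇒ ∘ ((f ⊗₁ g) ⊗₁ h))        ≡⟨ π₂-β-∘ _ _ _ ⟩
      ⟨ π₂ ∘ π₁ , π₂ ⟩ ∘ ((f ⊗₁ g) ⊗₁ h)  ≡⟨ ⟨⟩∘ _ _ _ ⟩
      ⟨ (π₂ ∘ π₁) ∘ ((f ⊗₁ g) ⊗₁ h) , π₂ ∘ ((f ⊗₁ g) ⊗₁ h) ⟩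
        ≡⟨ cong₂ ⟨_,_⟩ middle (π₂-β _ _) ⟩
      ⟨ g ∘ (π₂ ∘ π₁) , h ∘ π₂ ⟩          ≡⟨ sym (⊗∘⟨⟩ g h _ _) ⟩
      (g ⊗₁ h) ∘ ⟨ π₂ ∘ π₁ , π₂ ⟩         ≡⟨ cong ((g ⊗₁ h) ∘_) (sym (π₂-β _ _)) ⟩
      (g ⊗₁ h) ∘ (π₂ ∘ α⇒)               ≡⟨ sym (assoc _ _ _) ⟩
      ((g ⊗₁ h) ∘ π₂) ∘ α⇒               ≡⟨ sym (π₂-β-∘ _ _ _) ⟩
      π₂ ∘ ((f ⊗₁ (g ⊗₁ h)) ∘ α⇒)        ∎)
    where
      middle : (π₂ ∘ π₁) ∘ ((f ⊗₁ g) ⊗₁ h) ≡ g ∘ (π₂ ∘ π₁)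
      middle = begin
        (π₂ ∘ π₁) ∘ ((f ⊗₁ g) ⊗₁ h)  ≡⟨ trans (assoc _ _ _) (cong (π₂ ∘_) (π₁-β _ _)) ⟩
        π₂ ∘ ((f ⊗₁ g) ∘ π₁)         ≡⟨ trans (sym (assoc _ _ _)) (cong (_∘ π₁) (π₂-β _ _)) ⟩
        (g ∘ π₂) ∘ π₁                ≡⟨ assoc _ _ _ ⟩
        g ∘ (π₂ ∘ π₁)                ∎

  cast-⟨⟩ : ∀ {X X' A B} (e : X ≡ X') (f : X ⇒ A) (g : X ⇒ B) →
            cast e refl ⟨ f , g ⟩ ≡ ⟨ cast e refl f , cast e refl g ⟩
  cast-⟨⟩ refl f g = refl

  cast-⊗₁ʳ : ∀ {A B D D' X} (f : A ⇒ B) (e : D ≡ D') (g : X ⇒ D) →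
             cast refl (cong (B ⊗₀_) e) (f ⊗₁ g) ≡ f ⊗₁ cast refl e g
  cast-⊗₁ʳ f refl g = refl

  cast-π₁ : ∀ {A B B'} (e : B ≡ B') → cast (cong (A ⊗₀_) e) refl (π₁ {A} {B}) ≡ π₁
  cast-π₁ refl = refl

  cast-π₂ : ∀ {A B B'} (e : B ≡ B') → cast (cong (A ⊗₀_) e) e (π₂ {A} {B}) ≡ π₂
  cast-π₂ refl = refl

module ProductPreservation {o ℓ o' ℓ'}
         {V : Category o ℓ} {P : Category o' ℓ'}
         {VC : Cartesian V} {PC : Cartesian P} {p : Functor P V}
         (pres : StrictlyPreservesProducts VC PC p) where
  private
    module V = Category V
    module VC = Cartesian VC
    module P = Category P
    module PC = Cartesian PC
  open CastProperties V
  open CartesianProperties V VC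
  open Functor p
  open StrictlyPreservesProducts pres
  open ≡-Reasoning

  p-⟨⟩ : ∀ {x a b} (f : x P.⇒ a) (g : x P.⇒ b) →
         V.cast refl (⊗-obj a b) (F₁ PC.⟨ f , g ⟩) ≡ VC.⟨ F₁ f , F₁ g ⟩
  p-⟨⟩ {a = a} {b} f g = VC.⟨⟩-unique _ _ _ (p-π (PC.π₁-β f g) π₁-pres) (p-π (PC.π₂-β f g) π₂-pres)
    where
      p-π : ∀ {c} {πᴾ : a PC.⊗₀ b P.⇒ c} {πⱽ : F₀ a VC.⊗₀ F₀ b V.⇒ F₀ c}
            {h : _ P.⇒ c} → πᴾ P.∘ PC.⟨ f , g ⟩ ≡ h →
            V.cast (⊗-obj a b) refl (F₁ πᴾ) ≡ πⱽ →
            πⱽ V.∘ V.cast refl (⊗-obj a b) (F₁ PC.⟨ f , g ⟩) ≡ F₁ h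
      p-π {πᴾ = πᴾ} β πᴾ-pres = begin
        _ V.∘ V.cast refl (⊗-obj a b) (F₁ PC.⟨ f , g ⟩)
          ≡⟨ cong (V._∘ _) (sym πᴾ-pres) ⟩
        V.cast (⊗-obj a b) refl (F₁ πᴾ) V.∘ V.cast refl (⊗-obj a b) (F₁ PC.⟨ f , g ⟩)
          ≡⟨ sym (cast-∘ refl (⊗-obj a b) refl _ _) ⟩
        F₁ πᴾ V.∘ F₁ PC.⟨ f , g ⟩
          ≡⟨ sym (homomorphism _ _) ⟩
        F₁ (πᴾ P.∘ PC.⟨ f , g ⟩)
          ≡⟨ cong F₁ β ⟩
        _ ∎

  p-⊗₁ : ∀ {a b c d} (f : a P.⇒ c) (g : b P.⇒ d) →
         V.cast (⊗-obj a b) (⊗-obj c d) (F₁ (f PC.⊗₁ g)) ≡ F₁ f VC.⊗₁ F₁ g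
  p-⊗₁ {a} {b} {c} {d} f g = begin
      V.cast (⊗-obj a b) (⊗-obj c d) (F₁ (f PC.⊗₁ g))
        ≡⟨ cast-irrelevant _ (trans refl (⊗-obj a b)) _ (trans (⊗-obj c d) refl) _ ⟩
      V.cast (trans refl (⊗-obj a b)) (trans (⊗-obj c d) refl) (F₁ (f PC.⊗₁ g))
        ≡⟨ sym (cast-cast refl (⊗-obj c d) (⊗-obj a b) refl _) ⟩
      V.cast (⊗-obj a b) refl (V.cast refl (⊗-obj c d) (F₁ (f PC.⊗₁ g)))
        ≡⟨ cong (V.cast (⊗-obj a b) refl) (p-⟨⟩ _ _) ⟩
      V.cast (⊗-obj a b) refl VC.⟨ F₁ (f P.∘ PC.π₁) , F₁ (g P.∘ PC.π₂) ⟩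
        ≡⟨ cast-⟨⟩ (⊗-obj a b) _ _ ⟩
      VC.⟨ V.cast (⊗-obj a b) refl (F₁ (f P.∘ PC.π₁)) , V.cast (⊗-obj a b) refl (F₁ (g P.∘ PC.π₂)) ⟩
        ≡⟨ cong₂ VC.⟨_,_⟩ (p-∘π f π₁-pres) (p-∘π g π₂-pres) ⟩
      F₁ f VC.⊗₁ F₁ g ∎
    where
      p-∘π : ∀ {e e'} (h : e P.⇒ e') {πᴾ : a PC.⊗₀ b P.⇒ e} {πⱽ} →
             V.cast (⊗-obj a b) refl (F₁ πᴾ) ≡ πⱽ →
             V.cast (⊗-obj a b) refl (F₁ (h P.∘ πᴾ)) ≡ F₁ h V.∘ πⱽ
      p-∘π h πᴾ-pres = trans (cong (V.cast (⊗-obj a b) refl) (homomorphism _ _))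
                             (trans (cast-∘ (⊗-obj a b) refl refl _ _) (cong (F₁ h V.∘_) πᴾ-pres))

module FibrationProperties {o ℓ o' ℓ'}
         {V : Category o ℓ} {P : Category o' ℓ'}
         {VC : Cartesian V} {PC : Cartesian P} {p : Functor P V}
         (fib : Fibred.FibrationForAssertionLogic p VC)
         (pres : StrictlyPreservesProducts VC PC p) where
  open Category V
  open Cartesian VC
  open CastProperties V
  open CartesianProperties V VC
  open ProductPreservation pres
  private
    module P = Category P
    module PC = Cartesian PC
  open Functor p
  open Fibred p
  open Fibred.FibrationForAssertionLogic fib
  open StrictlyPreservesProducts pres
  open ≡-Reasoning

  infix 4 _≤[_]_
  _≤[_]_ : ∀ {X Y} → Fibre X → X ⇒ Y → Fibre Y → Set (ℓ ⊔ ℓ')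
  a ≤[ u ] b = Σ (proj₁ a P.⇒ proj₁ b) λ f → cast (proj₂ a) (proj₂ b) (F₁ f) ≡ u

  ⟦_⟧ : (a : P.Obj) → Fibre (F₀ a)
  ⟦ a ⟧ = a , refl

  infixl 5 _⟫_ _⨾_ _⨾ᵘ_ _ᵘ⨾_

  _⟫_ : ∀ {X Y Z} {a : Fibre X} {b : Fibre Y} {c : Fibre Z} {u v} →
        a ≤[ u ] b → b ≤[ v ] c → a ≤[ v ∘ u ] c
  _⟫_ {a = a} {b} {c} (f , ef) (g , eg) = g P.∘ f ,
    trans (cong (cast (proj₂ a) (proj₂ c)) (homomorphism g f))
          (trans (cast-∘ (proj₂ a) (proj₂ b) (proj₂ c) _ _) (cong₂ _∘_ eg ef))

  ≤[]-cong : ∀ {X Y} {a : Fibre X} {b : Fibre Y} {u u'} → u ≡ u' → a ≤[ u ] b → a ≤[ u' ] b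
  ≤[]-cong refl x = x

  ≤-refl : ∀ {X} (a : Fibre X) → a ≤ a
  ≤-refl a = P.id , trans (cong (cast (proj₂ a) (proj₂ a)) identity) (cast-id (proj₂ a))

  reindex-≤[] : ∀ {X Y} (u : X ⇒ Y) (φ : Fibre Y) → reindex u φ ≤[ u ] φ
  reindex-≤[] u φ = proj₁ (proj₂ (lift u φ)) , proj₁ (proj₂ (proj₂ (lift u φ)))

  ≤[]-factor : ∀ {X Y Z} {a : Fibre Z} (u : X ⇒ Y) {φ : Fibre Y} {v : Z ⇒ X} {w : Z ⇒ Y} →
               u ∘ v ≡ w → a ≤[ w ] φ → a ≤[ v ] reindex u φ
  ≤[]-factor {a = a , ea} u {φ , eφ} {v} uv (g , eg) = proj₁ (proj₁ factor) ,
    trans (cong (cast ea eψ) (proj₂ (proj₂ (proj₁ factor)))) (trans (cast-cast _ _ ea eψ v) (cast-trivial _ _ v))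
    where
      eψ = proj₂ (proj₁ (lift u (φ , eφ)))
      f = proj₁ (proj₂ (lift u (φ , eφ)))
      over-u : F₁ f ∘ cast (sym ea) (sym eψ) v ≡ F₁ g
      over-u = begin
        F₁ f ∘ cast (sym ea) (sym eψ) v                        ≡⟨ cong (_∘ cast (sym ea) (sym eψ) v)
                                                                    (cast-move eψ eφ (proj₁ (proj₂ (proj₂ (lift u (φ , eφ)))))) ⟩
        cast (sym eψ) (sym eφ) u ∘ cast (sym ea) (sym eψ) v    ≡⟨ sym (cast-∘ (sym ea) (sym eψ) (sym eφ) u v) ⟩
        cast (sym ea) (sym eφ) (u ∘ v)                          ≡⟨ cong (cast (sym ea) (sym eφ)) (trans uv (sym eg)) ⟩
        cast (sym ea) (sym eφ) (cast ea eφ (F₁ g))              ≡⟨ cast-sym-cast ea eφ (F₁ g) ⟩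
        F₁ g                                                    ∎
      factor = proj₂ (proj₂ (proj₂ (lift u (φ , eφ)))) g (cast (sym ea) (sym eψ) v) over-u

  ≤[]-factor-commutes : ∀ {X Y Z} {a : Fibre Z} (u : X ⇒ Y) {φ : Fibre Y} {v : Z ⇒ X} {w : Z ⇒ Y} →
    (uv : u ∘ v ≡ w) (x : a ≤[ w ] φ) → proj₁ (reindex-≤[] u φ) P.∘ proj₁ (≤[]-factor u uv x) ≡ proj₁ x
  ≤[]-factor-commutes u uv x = proj₁ (proj₂ (proj₁ (proj₂ (proj₂ (proj₂ (lift u _))) (proj₁ x) _ _)))

  -- Both morphisms factor through one cartesian lifting of F₁ f, and the factorisations agree as fibres are thin.
  p-faithful : ∀ {A B} (f g : A P.⇒ B) → F₁ f ≡ F₁ g → f ≡ g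
  p-faithful {A} {B} f g e = begin
    f                                   ≡⟨ sym (≤[]-factor-commutes (F₁ f) (identityʳ _) f-over) ⟩
    lifting P.∘ proj₁ (factor f-over)   ≡⟨ cong (lifting P.∘_) (thin (factor f-over) (factor g-over)) ⟩
    lifting P.∘ proj₁ (factor g-over)   ≡⟨ ≤[]-factor-commutes (F₁ f) (identityʳ _) g-over ⟩
    g                                   ∎
    where
      lifting = proj₁ (reindex-≤[] (F₁ f) ⟦ B ⟧)
      factor = ≤[]-factor (F₁ f) (identityʳ _)
      f-over : ⟦ A ⟧ ≤[ F₁ f ] ⟦ B ⟧
      f-over = f , refl
      g-over : ⟦ A ⟧ ≤[ F₁ f ] ⟦ B ⟧
      g-over = g , sym e

  ≤[]⇒≤reindex : ∀ {X Y} {a : Fibre X} {u : X ⇒ Y} {φ : Fibre Y} → a ≤[ u ] φ → a ≤ reindex u φ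
  ≤[]⇒≤reindex {u = u} = ≤[]-factor u (identityʳ u)

  ≤reindex⇒≤[] : ∀ {X Y} {a : Fibre X} {u : X ⇒ Y} {φ : Fibre Y} → a ≤ reindex u φ → a ≤[ u ] φ
  ≤reindex⇒≤[] {u = u} {φ} x = ≤[]-cong (identityʳ u) (x ⟫ reindex-≤[] u φ)

  _⨾_ : ∀ {X} {a b c : Fibre X} → a ≤ b → b ≤ c → a ≤ c
  x ⨾ y = ≤[]-cong (identityˡ id) (x ⟫ y)

  _⨾ᵘ_ : ∀ {X Y} {a b : Fibre X} {c : Fibre Y} {u} → a ≤ b → b ≤[ u ] c → a ≤[ u ] c
  _⨾ᵘ_ {u = u} x y = ≤[]-cong (identityʳ u) (x ⟫ y)

  _ᵘ⨾_ : ∀ {X Y} {a : Fibre X} {b c : Fibre Y} {u} → a ≤[ u ] b → b ≤ c → a ≤[ u ] c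
  _ᵘ⨾_ {u = u} x y = ≤[]-cong (identityˡ u) (x ⟫ y)

  ≤[]-⊤ : ∀ {X Y} (a : Fibre X) (u : X ⇒ Y) → a ≤[ u ] ⊤ Y
  ≤[]-⊤ a u = ≤reindex⇒≤[] (⊤-max a ⨾ proj₂ (reindex-⊤ u))

  ≤[]-∧ : ∀ {X Y} {a : Fibre X} {w : X ⇒ Y} {b b' : Fibre Y} →
          a ≤[ w ] b → a ≤[ w ] b' → a ≤[ w ] (b ∧ b')
  ≤[]-∧ {w = w} {b} {b'} x y = ≤reindex⇒≤[] (∧-glb (≤[]⇒≤reindex x) (≤[]⇒≤reindex y) ⨾ proj₂ (reindex-∧ w b b'))

  ∧-mono : ∀ {X} {a a' b b' : Fibre X} → a ≤ a' → b ≤ b' → a ∧ b ≤ a' ∧ b'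
  ∧-mono {a = a} {b = b} x y = ∧-glb (∧-lb₁ a b ⨾ x) (∧-lb₂ a b ⨾ y)

  ∧-comm : ∀ {X} (a b : Fibre X) → a ∧ b ≤ b ∧ a
  ∧-comm a b = ∧-glb (∧-lb₂ a b) (∧-lb₁ a b)

  Eq-mono : ∀ {X Y} {a b : Fibre (X ⊗₀ Y)} → a ≤ b → Eq a ≤ Eq b
  Eq-mono {a = a} {b} x = Eq-adj₂ a (Eq b) (x ⨾ Eq-adj₁ b (Eq b) (≤-refl (Eq b)))

  module _ {Γ Y : Obj} where
    keep₁ keep₂ : Γ ⊗₀ (Y ⊗₀ Y) ⇒ Γ ⊗₀ Y
    keep₁ = ⟨ π₁ , π₁ ∘ π₂ ⟩
    keep₂ = ⟨ π₁ , π₂ ∘ π₂ ⟩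

    keep∘c : ∀ {π : Y ⊗₀ Y ⇒ Y} → π ∘ ⟨ π₂ , π₂ ⟩ ≡ π₂ {Γ} {Y} → ⟨ π₁ , π ∘ π₂ ⟩ ∘ c ≡ id
    keep∘c {π} πδ = begin
      ⟨ π₁ , π ∘ π₂ ⟩ ∘ c                    ≡⟨ ⟨⟩∘ _ _ _ ⟩
      ⟨ π₁ ∘ c , (π ∘ π₂) ∘ c ⟩              ≡⟨ cong₂ ⟨_,_⟩ (π₁-β _ _) (trans (assoc _ _ _) (cong (π ∘_) (π₂-β _ _))) ⟩
      ⟨ π₁ , π ∘ ⟨ π₂ , π₂ ⟩ ⟩                ≡⟨ cong ⟨ π₁ ,_⟩ πδ ⟩
      ⟨ π₁ , π₂ ⟩                            ≡⟨ ⟨π₁,π₂⟩ ⟩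
      id                                     ∎

    Eq-Leibniz : (θ : Fibre (Γ ⊗₀ Y)) → Eq (⊤ (Γ ⊗₀ Y)) ∧ reindex keep₁ θ ≤ reindex keep₂ θ
    Eq-Leibniz θ = proj₂ (Eq-Frobenius (⊤ _) (reindex keep₁ θ)) ⨾ Eq-adj₂ _ _ (∧-lb₂ (⊤ _) _ ⨾ along-diagonal)
      where
        along-diagonal : reindex c (reindex keep₁ θ) ≤ reindex c (reindex keep₂ θ)
        along-diagonal = ≤[]⇒≤reindex (≤[]-factor keep₂
          (trans (keep∘c (π₂-β _ _)) (sym (keep∘c (π₁-β _ _))))
          (reindex-≤[] c (reindex keep₁ θ) ⟫ reindex-≤[] keep₁ θ))

  -- Σ_f ψ := ∃ x. (y = f x) ∧ ψ x, the left adjoint of reindexing along f.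
  module DirectImage {X Y : Obj} (f : X ⇒ Y) where
    graph : Y ⊗₀ X ⇒ 𝟙 ⊗₀ (Y ⊗₀ Y)
    graph = ⟨ ! , ⟨ f ∘ π₂ , π₁ ⟩ ⟩

    EqY : Fibre (𝟙 ⊗₀ (Y ⊗₀ Y))
    EqY = Eq {𝟙} {Y} (⊤ (𝟙 ⊗₀ Y))

    Graph : Fibre (Y ⊗₀ X)
    Graph = reindex graph EqY

    Θ : Fibre X → Fibre (Y ⊗₀ X)
    Θ ψ = Graph ∧ reindex π₂ ψ

    Σf : Fibre X → Fibre Y
    Σf ψ = ∃ (Θ ψ)

    graph∘⟨f,id⟩ : graph ∘ ⟨ f , id ⟩ ≡ c ∘ ⟨ ! , f ⟩
    graph∘⟨f,id⟩ = begin
      graph ∘ ⟨ f , id ⟩                                  ≡⟨ ⟨⟩∘ _ _ _ ⟩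
      ⟨ ! ∘ ⟨ f , id ⟩ , ⟨ f ∘ π₂ , π₁ ⟩ ∘ ⟨ f , id ⟩ ⟩   ≡⟨ cong₂ ⟨_,_⟩ (!-unique _) (trans (⟨⟩∘ _ _ _) (cong₂ ⟨_,_⟩
                                                              (trans (assoc _ _ _) (trans (cong (f ∘_) (π₂-β _ _)) (identityʳ f)))
                                                              (π₁-β _ _))) ⟩
      ⟨ ! , ⟨ f , f ⟩ ⟩                                   ≡⟨ sym (cong ⟨ ! ,_⟩ (trans (⟨⟩∘ _ _ _) (cong₂ ⟨_,_⟩ (π₂-β _ _) (π₂-β _ _)))) ⟩
      ⟨ ! , ⟨ π₂ , π₂ ⟩ ∘ ⟨ ! , f ⟩ ⟩                     ≡⟨ sym (trans (⟨⟩∘ _ _ _) (cong ⟨_, ⟨ π₂ , π₂ ⟩ ∘ ⟨ ! , f ⟩ ⟩ (π₁-β _ _))) ⟩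
      c ∘ ⟨ ! , f ⟩                                       ∎

    Σ-unit : (ψ : Fibre X) → ψ ≤[ f ] Σf ψ
    Σ-unit ψ = ≤[]-cong (π₁-β f id)
      (≤[]-∧ to-Graph to-ψ ⟫ ≤reindex⇒≤[] (∃-adj₁ (Θ ψ) (∃ (Θ ψ)) (≤-refl _)))
      where
        to-ψ : ψ ≤[ ⟨ f , id ⟩ ] reindex π₂ ψ
        to-ψ = ≤[]-factor π₂ (π₂-β f id) (≤-refl ψ)
        to-Graph : ψ ≤[ ⟨ f , id ⟩ ] Graph
        to-Graph = ≤[]-factor graph graph∘⟨f,id⟩
          (≤[]-⊤ ψ ⟨ ! , f ⟩ ᵘ⨾ Eq-adj₁ (⊤ _) EqY (≤-refl _) ⟫ reindex-≤[] c EqY)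

    Σ-universal : (ψ : Fibre X) (χ : Fibre Y) → ψ ≤[ f ] χ → Σf ψ ≤ χ
    Σ-universal ψ χ x = ∃-adj₂ (Θ ψ) χ (≤[]⇒≤reindex (≤[]-cong π₂∘keep₂∘graph
      (≤[]-∧ (∧-lb₁ Graph _ ⨾ᵘ reindex-≤[] graph EqY) (∧-lb₂ Graph _ ⨾ᵘ to-keep₁)
        ᵘ⨾ Eq-Leibniz θ ⟫ reindex-≤[] keep₂ θ ⟫ reindex-≤[] π₂ χ)))
      where
        θ : Fibre (𝟙 ⊗₀ Y)
        θ = reindex π₂ χ
        π₂∘keep₁∘graph : π₂ ∘ keep₁ ∘ graph ≡ f ∘ π₂
        π₂∘keep₁∘graph = trans (π₂-β-∘ _ _ _) (trans (assoc _ _ _) (trans (cong (π₁ ∘_) (π₂-β _ _)) (π₁-β _ _)))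
        π₂∘keep₂∘graph : π₂ ∘ keep₂ ∘ graph ≡ π₁
        π₂∘keep₂∘graph = trans (π₂-β-∘ _ _ _) (trans (assoc _ _ _) (trans (cong (π₂ ∘_) (π₂-β _ _)) (π₂-β _ _)))
        to-keep₁ : reindex π₂ ψ ≤[ graph ] reindex keep₁ θ
        to-keep₁ = ≤[]-factor keep₁ refl (≤[]-factor π₂ π₂∘keep₁∘graph (reindex-≤[] π₂ ψ ⟫ x))

    module _ {B : Obj} where
      drop-y : (B ⊗₀ Y) ⊗₀ X ⇒ B ⊗₀ X
      drop-y = ⟨ π₁ ∘ π₁ , π₂ ⟩
      pair-fx-y : (B ⊗₀ Y) ⊗₀ X ⇒ B ⊗₀ (Y ⊗₀ Y)
      pair-fx-y = ⟨ π₁ ∘ π₁ , ⟨ f ∘ π₂ , π₂ ∘ π₁ ⟩ ⟩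

      π₂∘drop-y : π₂ ∘ drop-y ≡ π₂ ∘ (π₂ ⊗₁ id {X})
      π₂∘drop-y = trans (π₂-β _ _) (sym (trans (π₂-β _ _) (identityˡ π₂)))

      graph-weakened : (! ⊗₁ (id ⊗₁ id)) ∘ pair-fx-y ≡ graph ∘ (π₂ ⊗₁ id {X})
      graph-weakened = ⟨⟩-ext
        (trans (π₁-β-∘ _ _ _) (trans (!-unique _) (sym (trans (π₁-β-∘ _ _ _) (!-unique _)))))
        (begin
          π₂ ∘ (! ⊗₁ (id ⊗₁ id)) ∘ pair-fx-y            ≡⟨ π₂-β-∘ _ _ _ ⟩
          ((id ⊗₁ id) ∘ π₂) ∘ pair-fx-y                 ≡⟨ cong (λ z → (z ∘ π₂) ∘ pair-fx-y) id⊗id ⟩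
          (id ∘ π₂) ∘ pair-fx-y                         ≡⟨ cong (_∘ pair-fx-y) (identityˡ π₂) ⟩
          π₂ ∘ pair-fx-y                                ≡⟨ π₂-β _ _ ⟩
          ⟨ f ∘ π₂ , π₂ ∘ π₁ ⟩                          ≡⟨ cong₂ ⟨_,_⟩ (cong (f ∘_) (sym (trans (π₂-β _ _) (identityˡ π₂))))
                                                                     (sym (π₁-β _ _)) ⟩
          ⟨ f ∘ π₂ ∘ (π₂ ⊗₁ id) , π₁ ∘ (π₂ ⊗₁ id) ⟩      ≡⟨ cong₂ ⟨_,_⟩ (sym (assoc _ _ _)) refl ⟩
          ⟨ (f ∘ π₂) ∘ (π₂ ⊗₁ id) , π₁ ∘ (π₂ ⊗₁ id) ⟩    ≡⟨ sym (⟨⟩∘ _ _ _) ⟩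
          ⟨ f ∘ π₂ , π₁ ⟩ ∘ (π₂ ⊗₁ id)                   ≡⟨ sym (π₂-β-∘ _ _ _) ⟩
          π₂ ∘ graph ∘ (π₂ ⊗₁ id)                       ∎)

      keep₁∘pair-fx-y : keep₁ ∘ pair-fx-y ≡ (id ⊗₁ f) ∘ drop-y
      keep₁∘pair-fx-y = begin
        ⟨ π₁ , π₁ ∘ π₂ ⟩ ∘ pair-fx-y                ≡⟨ ⟨⟩∘ _ _ _ ⟩
        ⟨ π₁ ∘ pair-fx-y , (π₁ ∘ π₂) ∘ pair-fx-y ⟩  ≡⟨ cong₂ ⟨_,_⟩ (π₁-β _ _)
                                                      (trans (assoc _ _ _) (trans (cong (π₁ ∘_) (π₂-β _ _)) (π₁-β _ _))) ⟩
        ⟨ π₁ ∘ π₁ , f ∘ π₂ ⟩                        ≡⟨ cong ⟨_, f ∘ π₂ ⟩ (sym (identityˡ _)) ⟩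
        ⟨ id ∘ π₁ ∘ π₁ , f ∘ π₂ ⟩                   ≡⟨ sym (⊗∘⟨⟩ id f _ _) ⟩
        (id ⊗₁ f) ∘ drop-y                          ∎

      keep₂∘pair-fx-y : keep₂ ∘ pair-fx-y ≡ π₁
      keep₂∘pair-fx-y = ⟨⟩-ext
        (trans (π₁-β-∘ _ _ _) (π₁-β _ _))
        (trans (π₂-β-∘ _ _ _) (trans (assoc _ _ _) (trans (cong (π₂ ∘_) (π₂-β _ _)) (π₂-β _ _))))

    Σ-universal-in-context : ∀ {B} (α : Fibre B) (ψ : Fibre X) (θ : Fibre (B ⊗₀ Y)) →
      reindex π₁ α ∧ reindex π₂ ψ ≤[ id ⊗₁ f ] θ → reindex π₁ α ∧ reindex π₂ (Σf ψ) ≤ θ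
    Σ-universal-in-context {B} α ψ θ hyp =
      ∧-mono (≤-refl _) (proj₁ (∃-BC π₂ (Θ ψ))) ⨾ ∧-comm _ _ ⨾ proj₂ (∃-Frobenius Θ' (reindex π₁ α))
      ⨾ ∃-adj₂ Ω θ (≤[]⇒≤reindex Ω-θ)
      where
        Θ' : Fibre ((B ⊗₀ Y) ⊗₀ X)
        Θ' = reindex (π₂ ⊗₁ id) (Θ ψ)
        Ω = Θ' ∧ reindex π₁ (reindex π₁ α)

        Ω-Θ : Ω ≤[ π₂ ⊗₁ id ] Θ ψ
        Ω-Θ = ∧-lb₁ _ _ ⨾ᵘ reindex-≤[] _ _
        Ω-α : Ω ≤[ π₁ ∘ π₁ ] α
        Ω-α = (∧-lb₂ _ _ ⨾ᵘ reindex-≤[] π₁ (reindex π₁ α)) ⟫ reindex-≤[] π₁ α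
        Ω-ψ : Ω ≤[ π₂ ∘ (π₂ ⊗₁ id) ] ψ
        Ω-ψ = Ω-Θ ᵘ⨾ ∧-lb₂ Graph _ ⟫ reindex-≤[] π₂ ψ
        Ω-Graph : Ω ≤[ graph ∘ (π₂ ⊗₁ id) ] EqY
        Ω-Graph = Ω-Θ ᵘ⨾ ∧-lb₁ _ _ ⟫ reindex-≤[] graph EqY
        Ω-keep₁ : Ω ≤[ pair-fx-y ] reindex keep₁ θ
        Ω-keep₁ = ≤[]-factor keep₁ keep₁∘pair-fx-y
          (≤[]-∧ (≤[]-factor π₁ (π₁-β _ _) Ω-α) (≤[]-factor π₂ π₂∘drop-y Ω-ψ) ⟫ hyp)
        Ω-Eq : Ω ≤[ pair-fx-y ] Eq (⊤ (B ⊗₀ Y))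
        Ω-Eq = ≤[]-factor (! ⊗₁ (id ⊗₁ id)) graph-weakened Ω-Graph
               ᵘ⨾ (proj₁ (Eq-BC ! (⊤ (𝟙 ⊗₀ Y))) ⨾ Eq-mono (⊤-max _))
        Ω-θ : Ω ≤[ π₁ ] θ
        Ω-θ = ≤[]-cong keep₂∘pair-fx-y (≤[]-∧ Ω-Eq Ω-keep₁ ᵘ⨾ Eq-Leibniz θ ⟫ reindex-≤[] keep₂ θ)

  reflect-coproduct : ∀ {I : Set} {X : I → P.Obj} {Z : P.Obj} {ι : ∀ i → X i P.⇒ Z}
    {X' : I → Obj} {C : Obj} {ιᵥ : ∀ i → X' i ⇒ C} (d : ∀ i → F₀ (X i) ≡ X' i) (e : F₀ Z ≡ C) →
    (isC : IsCoproduct _⇒_ _∘_ X' C ιᵥ) → (∀ i → cast (d i) e (F₁ (ι i)) ≡ ιᵥ i) →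
    (∀ {Y} (f : ∀ i → X i P.⇒ Y) → (Z , e) ≤[ IsCoproduct.copair isC (λ i → cast (d i) refl (F₁ (f i))) ] ⟦ Y ⟧) →
    IsCoproduct P._⇒_ P._∘_ X Z ι
  reflect-coproduct {ι = ι} {ιᵥ = ιᵥ} d e isC ι-over copair-lifts = record
    { copair        = λ f → proj₁ (copair-lifts f)
    ; copair-β      = λ f i → p-faithful _ _ (cast-injectiveˡ (d i) (begin
        cast (d i) refl (F₁ (proj₁ (copair-lifts f) P.∘ ι i))  ≡⟨ image-∘ₗ (proj₁ (copair-lifts f)) i ⟩
        cast e refl (F₁ (proj₁ (copair-lifts f))) ∘ ιᵥ i         ≡⟨ cong (_∘ _) (proj₂ (copair-lifts f)) ⟩
        C.copair _ ∘ ιᵥ i                                        ≡⟨ C.copair-β _ i ⟩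
        cast (d i) refl (F₁ (f i))                               ∎))
    ; copair-unique = λ h h' eq → p-faithful h h' (cast-injectiveˡ e (C.copair-unique _ _ (λ i →
        trans (sym (image-∘ₗ h i)) (trans (cong (λ z → cast (d i) refl (F₁ z)) (eq i)) (image-∘ₗ h' i)))))
    }
    where
      module C = IsCoproduct isC
      image-∘ₗ : ∀ {Y} (g : _ P.⇒ Y) i → cast (d i) refl (F₁ (g P.∘ ι i)) ≡ cast e refl (F₁ g) ∘ ιᵥ i
      image-∘ₗ g i = trans (cong (cast (d i) refl) (homomorphism _ _))
                           (trans (cast-∘ (d i) e refl _ _) (cong (_ ∘_) (ι-over i)))

  reindex-π₁∧reindex-π₂≤⊗ : (a b : P.Obj) → reindex π₁ ⟦ a ⟧ ∧ reindex π₂ ⟦ b ⟧ ≤ (a PC.⊗₀ b , ⊗-obj a b)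
  reindex-π₁∧reindex-π₂≤⊗ a b = PC.⟨ proj₁ to-a , proj₁ to-b ⟩ , (begin
      cast eM (⊗-obj a b) (F₁ PC.⟨ proj₁ to-a , proj₁ to-b ⟩)
        ≡⟨ cast-irrelevant _ (trans refl eM) _ (trans (⊗-obj a b) refl) _ ⟩
      cast (trans refl eM) (trans (⊗-obj a b) refl) (F₁ PC.⟨ proj₁ to-a , proj₁ to-b ⟩)
        ≡⟨ sym (cast-cast refl (⊗-obj a b) eM refl _) ⟩
      cast eM refl (cast refl (⊗-obj a b) (F₁ PC.⟨ proj₁ to-a , proj₁ to-b ⟩))
        ≡⟨ cong (cast eM refl) (p-⟨⟩ _ _) ⟩
      cast eM refl ⟨ F₁ (proj₁ to-a) , F₁ (proj₁ to-b) ⟩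
        ≡⟨ cast-⟨⟩ eM _ _ ⟩
      ⟨ cast eM refl (F₁ (proj₁ to-a)) , cast eM refl (F₁ (proj₁ to-b)) ⟩
        ≡⟨ cong₂ ⟨_,_⟩ (proj₂ to-a) (proj₂ to-b) ⟩
      ⟨ π₁ , π₂ ⟩
        ≡⟨ ⟨π₁,π₂⟩ ⟩
      id ∎)
    where
      eM = proj₂ (reindex π₁ ⟦ a ⟧ ∧ reindex π₂ ⟦ b ⟧)
      to-a : reindex π₁ ⟦ a ⟧ ∧ reindex π₂ ⟦ b ⟧ ≤[ π₁ ] ⟦ a ⟧
      to-a = ∧-lb₁ _ _ ⨾ᵘ reindex-≤[] π₁ ⟦ a ⟧
      to-b : reindex π₁ ⟦ a ⟧ ∧ reindex π₂ ⟦ b ⟧ ≤[ π₂ ] ⟦ b ⟧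
      to-b = ∧-lb₂ _ _ ⨾ᵘ reindex-≤[] π₂ ⟦ b ⟧

  module Coproduct (Vcop : DistributiveCountableCoproducts V VC)
                   {I : Set} (cI : Countable I) (X : I → P.Obj) where
    private
      module Vc = DistributiveCountableCoproducts Vcop
      module VCo = IsCoproduct (Vc.isCoproduct cI (λ i → F₀ (X i)))

    C : Obj
    C = Vc.∐ cI (λ i → F₀ (X i))

    ιᵥ : ∀ i → F₀ (X i) ⇒ C
    ιᵥ = Vc.ι cI (λ i → F₀ (X i))

    S : I → Fibre C
    S i = DirectImage.Σf (ιᵥ i) ⟦ X i ⟧

    ∐X : Fibre C
    ∐X = ⋁ cI S

    Z : P.Obj
    Z = proj₁ ∐X

    ι-over : ∀ i → ⟦ X i ⟧ ≤[ ιᵥ i ] ∐X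
    ι-over i = DirectImage.Σ-unit (ιᵥ i) ⟦ X i ⟧ ᵘ⨾ ⋁-ub cI S i

    ι : ∀ i → X i P.⇒ Z
    ι i = proj₁ (ι-over i)

    p-isCoproduct : IsCoproduct _⇒_ _∘_ (λ i → F₀ (X i)) (F₀ Z) (λ i → F₁ (ι i))
    p-isCoproduct = IsCoproduct-cast (proj₂ ∐X) (λ i → proj₂ (ι-over i)) (Vc.isCoproduct cI _)

    isCoproduct : IsCoproduct P._⇒_ P._∘_ X Z ι
    isCoproduct = reflect-coproduct (λ _ → refl) (proj₂ ∐X) (Vc.isCoproduct cI _) (λ i → proj₂ (ι-over i))
      (λ {Y} f → ≤reindex⇒≤[] (⋁-lub cI S _ (λ i → DirectImage.Σ-universal (ιᵥ i) ⟦ X i ⟧ _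
         (≤[]-factor _ (VCo.copair-β _ i) (f i , refl)))))

    module _ (A : P.Obj) where
      private
        module D = IsCoproduct (Vc.distributive cI (λ i → F₀ (X i)) (F₀ A))
        e : F₀ (A PC.⊗₀ Z) ≡ F₀ A ⊗₀ C
        e = trans (⊗-obj A Z) (cong (F₀ A ⊗₀_) (proj₂ ∐X))

        cast-split : ∀ {B B'} (e' : B ≡ B') (x : F₀ (A PC.⊗₀ Z) ⇒ B) →
                     cast e e' x ≡ cast (cong (F₀ A ⊗₀_) (proj₂ ∐X)) e' (cast (⊗-obj A Z) refl x)
        cast-split e' x = trans (cast-irrelevant e _ e' (trans refl e') x)
                                (sym (cast-cast (⊗-obj A Z) refl (cong (F₀ A ⊗₀_) (proj₂ ∐X)) e' x))

        A⊗∐X≤ : (A PC.⊗₀ Z , e) ≤ reindex π₁ ⟦ A ⟧ ∧ reindex π₂ ∐X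
        A⊗∐X≤ = ∧-glb
          (≤[]⇒≤reindex (PC.π₁ , trans (cast-split refl _)
             (trans (cong (cast (cong (F₀ A ⊗₀_) (proj₂ ∐X)) refl) π₁-pres) (cast-π₁ (proj₂ ∐X)))))
          (≤[]⇒≤reindex (PC.π₂ , trans (cast-split (proj₂ ∐X) _)
             (trans (cong (cast (cong (F₀ A ⊗₀_) (proj₂ ∐X)) (proj₂ ∐X)) π₂-pres) (cast-π₂ (proj₂ ∐X)))))

        id⊗ι-over : ∀ i → cast (⊗-obj A (X i)) e (F₁ (P.id PC.⊗₁ ι i)) ≡ id ⊗₁ ιᵥ i
        id⊗ι-over i = begin
          cast (⊗-obj A (X i)) e (F₁ (P.id PC.⊗₁ ι i))
            ≡⟨ cast-irrelevant _ (trans (⊗-obj A (X i)) refl) _ _ _ ⟩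
          cast (trans (⊗-obj A (X i)) refl) e (F₁ (P.id PC.⊗₁ ι i))
            ≡⟨ sym (cast-cast (⊗-obj A (X i)) (⊗-obj A Z) refl (cong (F₀ A ⊗₀_) (proj₂ ∐X)) _) ⟩
          cast refl (cong (F₀ A ⊗₀_) (proj₂ ∐X)) (cast (⊗-obj A (X i)) (⊗-obj A Z) (F₁ (P.id PC.⊗₁ ι i)))
            ≡⟨ cong (cast refl (cong (F₀ A ⊗₀_) (proj₂ ∐X))) (p-⊗₁ _ _) ⟩
          cast refl (cong (F₀ A ⊗₀_) (proj₂ ∐X)) (F₁ P.id ⊗₁ F₁ (ι i))
            ≡⟨ cast-⊗₁ʳ (F₁ P.id) (proj₂ ∐X) (F₁ (ι i)) ⟩
          F₁ P.id ⊗₁ cast refl (proj₂ ∐X) (F₁ (ι i))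
            ≡⟨ cong₂ _⊗₁_ identity (proj₂ (ι-over i)) ⟩
          id ⊗₁ ιᵥ i ∎

      isDistributive : IsCoproduct P._⇒_ P._∘_ (λ i → A PC.⊗₀ X i) (A PC.⊗₀ Z) (λ i → P.id PC.⊗₁ ι i)
      isDistributive = reflect-coproduct (λ i → ⊗-obj A (X i)) e
        (Vc.distributive cI (λ i → F₀ (X i)) (F₀ A)) id⊗ι-over
        (λ f → ≤reindex⇒≤[] (A⊗∐X≤ ⨾ ∧-mono (≤-refl _) (proj₁ (reindex-⋁ π₂ cI S)) ⨾ distributive cI _ _
           ⨾ ⋁-lub cI _ _ (λ i → DirectImage.Σ-universal-in-context (ιᵥ i) ⟦ A ⟧ ⟦ X i ⟧ _
               (≤[]-factor _ (D.copair-β _ i) (reindex-π₁∧reindex-π₂≤⊗ A (X i) ⨾ᵘ (f i , refl))))))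

  distributiveCountableCoproducts : DistributiveCountableCoproducts V VC → DistributiveCountableCoproducts P PC
  distributiveCountableCoproducts Vcop = record
    { ∐            = λ c X → Coproduct.Z Vcop c X
    ; ι            = λ c X → Coproduct.ι Vcop c X
    ; isCoproduct  = λ c X → Coproduct.isCoproduct Vcop c X
    ; distributive = λ c X A → Coproduct.isDistributive Vcop c X A
    }

module KleisliGradedFreydProperties (M : PreorderedMonoid) {o ℓ o' ℓ'}
         {V : Category o ℓ} {P : Category o' ℓ'}
         {VC : Cartesian V} {PC : Cartesian P} {p : Functor P V}
         {pres : StrictlyPreservesProducts VC PC p} {T : StrongMonad V VC}
         (Ṫ : GradedLifting M pres T) where
  open PreorderedMonoid M
  open Category P
  open Cartesian PC
  open CartesianProperties P PC
  open GradedLifting Ṫ renaming (identityˡ to μ̇-identityˡ; identityʳ to μ̇-identityʳ; assoc to μ̇-assoc)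
  open ≡-Reasoning

  Kl : Obj → Obj → Carrier → Set ℓ'
  Kl ψ φ m = ψ ⇒ Ṫ₀ m φ

  infixr 9 _⊙_
  _⊙_ : ∀ {ψ φ χ m n} → Kl φ χ n → Kl ψ φ m → Kl ψ χ (m · n)
  _⊙_ {m = m} g f = μ̇ ∘ Ṫ₁ m g ∘ f

  J : ∀ {ψ φ} → ψ ⇒ φ → Kl ψ φ ε
  J f = η̇ ∘ f

  infixr 10 _⊛_
  _⊛_ : ∀ {ψ φ χ ω m} → ψ ⇒ φ → Kl χ ω m → Kl (ψ ⊗₀ χ) (φ ⊗₀ ω) m
  f ⊛ g = ṡt ∘ (f ⊗₁ g)

  infixl 6 _◁_
  _◁_ : ∀ {ψ φ χ m} → Kl φ χ m → Kl ψ φ ε → Kl ψ χ m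
  _◁_ {ψ} {χ = χ} {m} h f = subst (Kl ψ χ) (·-identityˡ m) (h ⊙ f)

  subst-∘ : ∀ {ψ φ χ m n} (e : m ≡ n) (x : Kl φ χ m) (f : ψ ⇒ φ) →
            subst (Kl ψ χ) e (x ∘ f) ≡ subst (Kl φ χ) e x ∘ f
  subst-∘ refl x f = refl

  μ̇∘Ṫ₁η̇-∘ : ∀ {ψ φ m} (f : Kl ψ φ m) → subst (Kl ψ φ) (·-identityʳ m) ((μ̇ ∘ Ṫ₁ m η̇) ∘ f) ≡ f
  μ̇∘Ṫ₁η̇-∘ {m = m} f = trans (subst-∘ (·-identityʳ m) _ f) (trans (cong (_∘ f) μ̇-identityʳ) (identityˡ f))

  μ̇∘η̇-∘ : ∀ {ψ φ m} (f : Kl ψ φ m) → subst (Kl ψ φ) (·-identityˡ m) ((μ̇ ∘ η̇) ∘ f) ≡ f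
  μ̇∘η̇-∘ {m = m} f = trans (subst-∘ (·-identityˡ m) _ f) (trans (cong (_∘ f) μ̇-identityˡ) (identityˡ f))

  ◁-J : ∀ {ψ φ χ m} (h : Kl φ χ m) (j : ψ ⇒ φ) → h ◁ J j ≡ h ∘ j
  ◁-J {m = m} h j = begin
    subst _ (·-identityˡ m) (μ̇ ∘ Ṫ₁ ε h ∘ η̇ ∘ j)     ≡⟨ cong (λ z → subst _ (·-identityˡ m) (μ̇ ∘ z)) (begin
        Ṫ₁ ε h ∘ η̇ ∘ j                               ≡⟨ sym (assoc _ _ _) ⟩
        (Ṫ₁ ε h ∘ η̇) ∘ j                             ≡⟨ cong (_∘ j) (η̇-natural h) ⟩
        (η̇ ∘ h) ∘ j                                  ≡⟨ assoc _ _ _ ⟩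
        η̇ ∘ h ∘ j                                    ∎) ⟩
    subst _ (·-identityˡ m) (μ̇ ∘ η̇ ∘ h ∘ j)         ≡⟨ cong (subst _ (·-identityˡ m)) (sym (assoc _ _ _)) ⟩
    subst _ (·-identityˡ m) ((μ̇ ∘ η̇) ∘ h ∘ j)       ≡⟨ μ̇∘η̇-∘ _ ⟩
    h ∘ j                                            ∎

  η̇-⊙ : ∀ {ψ φ m} (f : Kl ψ φ m) → subst (Kl ψ φ) (·-identityʳ m) (η̇ ⊙ f) ≡ f
  η̇-⊙ {m = m} f = trans (cong (subst _ (·-identityʳ m)) (sym (assoc _ _ f))) (μ̇∘Ṫ₁η̇-∘ f)

  ◁-η̇ : ∀ {ψ φ m} (h : Kl ψ φ m) → h ◁ η̇ ≡ h
  ◁-η̇ h = trans (cong (h ◁_) (sym (identityʳ η̇))) (trans (◁-J h id) (identityʳ h))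

  J-⊙ : ∀ {ψ φ χ m} (j : φ ⇒ χ) (f : Kl ψ φ m) →
        subst (Kl ψ χ) (·-identityʳ m) (J j ⊙ f) ≡ Ṫ₁ m j ∘ f
  J-⊙ {m = m} j f = begin
    subst _ (·-identityʳ m) (μ̇ ∘ Ṫ₁ m (η̇ ∘ j) ∘ f)       ≡⟨ cong (λ z → subst _ (·-identityʳ m) (μ̇ ∘ z ∘ f))
                                                             (Ṫ-homomorphism m η̇ j) ⟩
    subst _ (·-identityʳ m) (μ̇ ∘ (Ṫ₁ m η̇ ∘ Ṫ₁ m j) ∘ f)  ≡⟨ cong (subst _ (·-identityʳ m))
                                                             (trans (cong (μ̇ ∘_) (assoc _ _ _)) (sym (assoc _ _ _))) ⟩
    subst _ (·-identityʳ m) ((μ̇ ∘ Ṫ₁ m η̇) ∘ Ṫ₁ m j ∘ f)  ≡⟨ μ̇∘Ṫ₁η̇-∘ _ ⟩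
    Ṫ₁ m j ∘ f                                          ∎

  ⊙-assoc : ∀ {ψ φ χ ω m n k} (h : Kl χ ω k) (g : Kl φ χ n) (f : Kl ψ φ m) →
            subst (Kl ψ ω) (·-assoc m n k) (h ⊙ g ⊙ f) ≡ (h ⊙ g) ⊙ f
  ⊙-assoc {ψ} {ω = ω} {m} {n} {k} h g f = begin
    subst (Kl ψ ω) (·-assoc m n k) (μ̇ ∘ Ṫ₁ (m · n) h ∘ μ̇ ∘ Ṫ₁ m g ∘ f)
      ≡⟨ cong (λ z → subst (Kl ψ ω) (·-assoc m n k) (μ̇ ∘ z))
           (trans (sym (assoc _ _ _)) (trans (cong (_∘ Ṫ₁ m g ∘ f) (μ̇-natural h)) (assoc _ _ _))) ⟩
    subst (Kl ψ ω) (·-assoc m n k) (μ̇ ∘ μ̇ ∘ Ṫ₁ m (Ṫ₁ n h) ∘ Ṫ₁ m g ∘ f)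
      ≡⟨ cong (subst (Kl ψ ω) (·-assoc m n k)) (sym (assoc _ _ _)) ⟩
    subst (Kl ψ ω) (·-assoc m n k) ((μ̇ ∘ μ̇) ∘ Ṫ₁ m (Ṫ₁ n h) ∘ Ṫ₁ m g ∘ f)
      ≡⟨ subst-∘ (·-assoc m n k) _ _ ⟩
    subst (Kl _ ω) (·-assoc m n k) (μ̇ ∘ μ̇) ∘ Ṫ₁ m (Ṫ₁ n h) ∘ Ṫ₁ m g ∘ f
      ≡⟨ cong (_∘ Ṫ₁ m (Ṫ₁ n h) ∘ Ṫ₁ m g ∘ f) μ̇-assoc ⟩
    (μ̇ ∘ Ṫ₁ m μ̇) ∘ Ṫ₁ m (Ṫ₁ n h) ∘ Ṫ₁ m g ∘ f
      ≡⟨ assoc _ _ _ ⟩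
    μ̇ ∘ Ṫ₁ m μ̇ ∘ Ṫ₁ m (Ṫ₁ n h) ∘ Ṫ₁ m g ∘ f
      ≡⟨ cong (μ̇ ∘_) (begin
          Ṫ₁ m μ̇ ∘ Ṫ₁ m (Ṫ₁ n h) ∘ Ṫ₁ m g ∘ f      ≡⟨ sym (assoc _ _ _) ⟩
          (Ṫ₁ m μ̇ ∘ Ṫ₁ m (Ṫ₁ n h)) ∘ Ṫ₁ m g ∘ f    ≡⟨ cong (_∘ Ṫ₁ m g ∘ f) (sym (Ṫ-homomorphism m _ _)) ⟩
          Ṫ₁ m (μ̇ ∘ Ṫ₁ n h) ∘ Ṫ₁ m g ∘ f           ≡⟨ sym (assoc _ _ _) ⟩
          (Ṫ₁ m (μ̇ ∘ Ṫ₁ n h) ∘ Ṫ₁ m g) ∘ f         ≡⟨ cong (_∘ f) (sym (Ṫ-homomorphism m _ _)) ⟩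
          Ṫ₁ m ((μ̇ ∘ Ṫ₁ n h) ∘ g) ∘ f              ≡⟨ cong (λ z → Ṫ₁ m z ∘ f) (assoc _ _ _) ⟩
          Ṫ₁ m (h ⊙ g) ∘ f                        ∎) ⟩
    (h ⊙ g) ⊙ f ∎

  ⊙-up : ∀ {ψ φ χ m m' n n'} (a : m ≤ m') (b : n ≤ n') (g : Kl φ χ n) (f : Kl ψ φ m) →
         (Ṫ≤ b ∘ g) ⊙ (Ṫ≤ a ∘ f) ≡ Ṫ≤ (·-mono a b) ∘ g ⊙ f
  ⊙-up {m = m} {m'} a b g f = begin
    μ̇ ∘ Ṫ₁ m' (Ṫ≤ b ∘ g) ∘ Ṫ≤ a ∘ f
      ≡⟨ cong (μ̇ ∘_) (trans (cong (_∘ Ṫ≤ a ∘ f) (Ṫ-homomorphism m' _ _)) (assoc _ _ _)) ⟩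
    μ̇ ∘ Ṫ₁ m' (Ṫ≤ b) ∘ Ṫ₁ m' g ∘ Ṫ≤ a ∘ f
      ≡⟨ cong (λ z → μ̇ ∘ Ṫ₁ m' (Ṫ≤ b) ∘ z)
           (trans (sym (assoc _ _ _)) (trans (cong (_∘ f) (Ṫ≤-natural a g)) (assoc _ _ _))) ⟩
    μ̇ ∘ Ṫ₁ m' (Ṫ≤ b) ∘ Ṫ≤ a ∘ Ṫ₁ m g ∘ f
      ≡⟨ cong (μ̇ ∘_) (trans (sym (assoc _ _ _)) (trans (cong (_∘ Ṫ₁ m g ∘ f) (Ṫ≤-natural a (Ṫ≤ b))) (assoc _ _ _))) ⟩
    μ̇ ∘ Ṫ≤ a ∘ Ṫ₁ m (Ṫ≤ b) ∘ Ṫ₁ m g ∘ f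
      ≡⟨ sym (trans (assoc _ _ _) (cong (μ̇ ∘_) (assoc _ _ _))) ⟩
    (μ̇ ∘ Ṫ≤ a ∘ Ṫ₁ m (Ṫ≤ b)) ∘ Ṫ₁ m g ∘ f
      ≡⟨ cong (_∘ Ṫ₁ m g ∘ f) (sym (μ̇-Ṫ≤ a b)) ⟩
    (Ṫ≤ (·-mono a b) ∘ μ̇) ∘ Ṫ₁ m g ∘ f
      ≡⟨ assoc _ _ _ ⟩
    Ṫ≤ (·-mono a b) ∘ g ⊙ f ∎

  kleisli-isGradedCategory : IsGradedCategory (KleisliGradedCategory M Ṫ)
  kleisli-isGradedCategory = record
    { up-refl   = λ f → trans (cong (_∘ f) Ṫ≤-refl) (identityˡ f)
    ; up-trans  = λ a b f → trans (sym (assoc _ _ f)) (cong (_∘ f) (sym (Ṫ≤-trans a b)))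
    ; identityˡ = η̇-⊙
    ; identityʳ = ◁-η̇
    ; assoc     = ⊙-assoc
    ; comp-up   = ⊙-up
    }

  J-⊗ : ∀ {ψ φ χ ω} (f : ψ ⇒ φ) (g : χ ⇒ ω) → J (f ⊗₁ g) ≡ f ⊛ J g
  J-⊗ f g = sym (begin
    ṡt ∘ (f ⊗₁ (η̇ ∘ g))          ≡⟨ cong (ṡt ∘_) (sym (id⊗∘⊗ η̇ f g)) ⟩
    ṡt ∘ (id ⊗₁ η̇) ∘ (f ⊗₁ g)    ≡⟨ sym (assoc _ _ _) ⟩
    (ṡt ∘ (id ⊗₁ η̇)) ∘ (f ⊗₁ g)  ≡⟨ cong (_∘ (f ⊗₁ g)) ṡt-η ⟩
    η̇ ∘ (f ⊗₁ g)                 ∎)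

  ⊛-up : ∀ {ψ φ χ ω m n} (a : m ≤ n) (f : ψ ⇒ φ) (g : Kl χ ω m) → f ⊛ (Ṫ≤ a ∘ g) ≡ Ṫ≤ a ∘ f ⊛ g
  ⊛-up a f g = begin
    ṡt ∘ (f ⊗₁ (Ṫ≤ a ∘ g))          ≡⟨ cong (ṡt ∘_) (sym (id⊗∘⊗ (Ṫ≤ a) f g)) ⟩
    ṡt ∘ (id ⊗₁ Ṫ≤ a) ∘ (f ⊗₁ g)    ≡⟨ sym (assoc _ _ _) ⟩
    (ṡt ∘ (id ⊗₁ Ṫ≤ a)) ∘ (f ⊗₁ g)  ≡⟨ cong (_∘ (f ⊗₁ g)) (sym (ṡt-Ṫ≤ a)) ⟩
    (Ṫ≤ a ∘ ṡt) ∘ (f ⊗₁ g)          ≡⟨ assoc _ _ _ ⟩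
    Ṫ≤ a ∘ ṡt ∘ (f ⊗₁ g)            ∎

  ⊛-⊙ : ∀ {ψ φ χ ψ' φ' χ' m n} (f' : φ ⇒ χ) (f : ψ ⇒ φ) (g' : Kl φ' χ' n) (g : Kl ψ' φ' m) →
        (f' ∘ f) ⊛ (g' ⊙ g) ≡ (f' ⊛ g') ⊙ (f ⊛ g)
  ⊛-⊙ {m = m} f' f g' g = sym (begin
    μ̇ ∘ Ṫ₁ m (ṡt ∘ (f' ⊗₁ g')) ∘ ṡt ∘ (f ⊗₁ g)
      ≡⟨ cong (λ z → μ̇ ∘ z ∘ ṡt ∘ (f ⊗₁ g)) (Ṫ-homomorphism m ṡt (f' ⊗₁ g')) ⟩
    μ̇ ∘ (Ṫ₁ m ṡt ∘ Ṫ₁ m (f' ⊗₁ g')) ∘ ṡt ∘ (f ⊗₁ g)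
      ≡⟨ cong (μ̇ ∘_) (trans (assoc _ _ _) (cong (Ṫ₁ m ṡt ∘_) (sym (assoc _ _ _)))) ⟩
    μ̇ ∘ Ṫ₁ m ṡt ∘ (Ṫ₁ m (f' ⊗₁ g') ∘ ṡt) ∘ (f ⊗₁ g)
      ≡⟨ cong (λ z → μ̇ ∘ Ṫ₁ m ṡt ∘ z ∘ (f ⊗₁ g)) (sym (ṡt-natural f' g')) ⟩
    μ̇ ∘ Ṫ₁ m ṡt ∘ (ṡt ∘ (f' ⊗₁ Ṫ₁ m g')) ∘ (f ⊗₁ g)
      ≡⟨ cong (λ z → μ̇ ∘ Ṫ₁ m ṡt ∘ z) (assoc _ _ _) ⟩
    μ̇ ∘ Ṫ₁ m ṡt ∘ ṡt ∘ (f' ⊗₁ Ṫ₁ m g') ∘ (f ⊗₁ g)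
      ≡⟨ sym (trans (assoc _ _ _) (cong (μ̇ ∘_) (assoc _ _ _))) ⟩
    (μ̇ ∘ Ṫ₁ m ṡt ∘ ṡt) ∘ (f' ⊗₁ Ṫ₁ m g') ∘ (f ⊗₁ g)
      ≡⟨ cong (_∘ (f' ⊗₁ Ṫ₁ m g') ∘ (f ⊗₁ g)) (sym ṡt-μ) ⟩
    (ṡt ∘ (id ⊗₁ μ̇)) ∘ (f' ⊗₁ Ṫ₁ m g') ∘ (f ⊗₁ g)
      ≡⟨ trans (assoc _ _ _) (cong (ṡt ∘_) (trans (cong ((id ⊗₁ μ̇) ∘_) (⊗∘⊗ _ _ _ _)) (id⊗∘⊗ _ _ _))) ⟩
    ṡt ∘ ((f' ∘ f) ⊗₁ (g' ⊙ g))
      ∎)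

  unitor-natural : ∀ {ψ φ m} (g : Kl ψ φ m) →
                   subst (Kl (𝟙 ⊗₀ ψ) φ) (·-identityʳ m) (J λ⇒ ⊙ id ⊛ g)
                   ≡ subst (Kl (𝟙 ⊗₀ ψ) φ) (·-identityˡ m) (g ⊙ J λ⇒)
  unitor-natural {m = m} g = begin
    subst _ (·-identityʳ m) (J π₂ ⊙ id ⊛ g)  ≡⟨ J-⊙ π₂ (id ⊛ g) ⟩
    Ṫ₁ m π₂ ∘ ṡt ∘ (id ⊗₁ g)                 ≡⟨ sym (assoc _ _ _) ⟩
    (Ṫ₁ m π₂ ∘ ṡt) ∘ (id ⊗₁ g)               ≡⟨ cong (_∘ (id ⊗₁ g)) ṡt-unitor ⟩
    π₂ ∘ (id ⊗₁ g)                           ≡⟨ π₂-β _ _ ⟩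
    g ∘ π₂                                   ≡⟨ sym (◁-J g π₂) ⟩
    g ◁ J π₂                                 ∎

  associator-natural : ∀ {ψ ψ' φ φ' χ ω m} (f : ψ ⇒ ψ') (g : φ ⇒ φ') (h : Kl χ ω m) →
    subst (Kl ((ψ ⊗₀ φ) ⊗₀ χ) (ψ' ⊗₀ (φ' ⊗₀ ω))) (·-identityʳ m) (J α⇒ ⊙ (f ⊗₁ g) ⊛ h)
    ≡ subst (Kl ((ψ ⊗₀ φ) ⊗₀ χ) (ψ' ⊗₀ (φ' ⊗₀ ω))) (·-identityˡ m) ((f ⊛ g ⊛ h) ⊙ J α⇒)
  associator-natural {m = m} f g h = begin
    subst _ (·-identityʳ m) (J α⇒ ⊙ (f ⊗₁ g) ⊛ h)  ≡⟨ J-⊙ α⇒ ((f ⊗₁ g) ⊛ h) ⟩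
    Ṫ₁ m α⇒ ∘ ṡt ∘ ((f ⊗₁ g) ⊗₁ h)                 ≡⟨ sym (assoc _ _ _) ⟩
    (Ṫ₁ m α⇒ ∘ ṡt) ∘ ((f ⊗₁ g) ⊗₁ h)               ≡⟨ cong (_∘ ((f ⊗₁ g) ⊗₁ h)) ṡt-assoc ⟩
    (ṡt ∘ (id ⊗₁ ṡt) ∘ α⇒) ∘ ((f ⊗₁ g) ⊗₁ h)       ≡⟨ trans (assoc _ _ _) (cong (ṡt ∘_) (assoc _ _ _)) ⟩
    ṡt ∘ (id ⊗₁ ṡt) ∘ α⇒ ∘ ((f ⊗₁ g) ⊗₁ h)         ≡⟨ cong (λ z → ṡt ∘ (id ⊗₁ ṡt) ∘ z) (α⇒-natural f g h) ⟩
    ṡt ∘ (id ⊗₁ ṡt) ∘ (f ⊗₁ (g ⊗₁ h)) ∘ α⇒         ≡⟨ cong (ṡt ∘_) (sym (assoc _ _ _)) ⟩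
    ṡt ∘ ((id ⊗₁ ṡt) ∘ (f ⊗₁ (g ⊗₁ h))) ∘ α⇒       ≡⟨ cong (λ z → ṡt ∘ z ∘ α⇒) (id⊗∘⊗ ṡt f (g ⊗₁ h)) ⟩
    ṡt ∘ (f ⊗₁ g ⊛ h) ∘ α⇒                         ≡⟨ sym (assoc _ _ _) ⟩
    (f ⊛ g ⊛ h) ∘ α⇒                               ≡⟨ sym (◁-J (f ⊛ g ⊛ h) α⇒) ⟩
    (f ⊛ g ⊛ h) ◁ J α⇒                             ∎

  kleisli-isGradedFreyd : IsGradedFreyd (KleisliGradedFreyd M Ṫ)
  kleisli-isGradedFreyd = record
    { isGradedCategory   = kleisli-isGradedCategory
    ; I-identity         = identityʳ η̇
    ; I-homomorphism     = λ g f → trans (◁-J (J g) f) (assoc _ _ _)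
    ; I-⊗                = J-⊗
    ; ⊛-identity         = ṡt-η
    ; ⊛-homomorphism     = ⊛-⊙
    ; ⊛-up               = ⊛-up
    ; unitor-natural     = unitor-natural
    ; associator-natural = associator-natural
    }

  ⊙-substˡ : ∀ {ψ φ χ j k n} (e : j ≡ k) (h : Kl φ χ j) (f : Kl ψ φ n) →
             subst (Kl φ χ) e h ⊙ f ≡ subst (Kl ψ χ) (cong (n ·_) e) (h ⊙ f)
  ⊙-substˡ refl h f = refl

  ⊙-substʳ : ∀ {ψ φ χ j k n} (e : j ≡ k) (h : Kl φ χ n) (f : Kl ψ φ j) →
             h ⊙ subst (Kl ψ φ) e f ≡ subst (Kl ψ χ) (cong (_· n) e) (h ⊙ f)
  ⊙-substʳ refl h f = refl

  ◁-assoc : ∀ {ψ φ χ ω m} (h : Kl χ ω m) (g : Kl φ χ ε) (f : Kl ψ φ ε) →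
            (h ◁ g) ◁ f ≡ h ◁ (g ◁ f)
  ◁-assoc {ψ} {ω = ω} {m} h g f = begin
    (h ◁ g) ◁ f
      ≡⟨ cong (subst K e) (⊙-substˡ e (h ⊙ g) f) ⟩
    subst K e (subst K (cong (ε ·_) e) ((h ⊙ g) ⊙ f))
      ≡⟨ cong (λ z → subst K e (subst K (cong (ε ·_) e) z)) (sym (⊙-assoc h g f)) ⟩
    subst K e (subst K (cong (ε ·_) e) (subst K (·-assoc ε ε m) (h ⊙ g ⊙ f)))
      ≡⟨ trans (cong (subst K e) (subst-subst {P = K} (·-assoc ε ε m))) (subst-subst {P = K} (trans (·-assoc ε ε m) (cong (ε ·_) e))) ⟩
    subst K (trans (trans (·-assoc ε ε m) (cong (ε ·_) e)) e) (h ⊙ g ⊙ f)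
      ≡⟨ cong (λ p → subst K p (h ⊙ g ⊙ f)) (uip _ _) ⟩
    subst K (trans (cong (_· m) (·-identityˡ ε)) e) (h ⊙ g ⊙ f)
      ≡⟨ sym (subst-subst {P = K} (cong (_· m) (·-identityˡ ε))) ⟩
    subst K e (subst K (cong (_· m) (·-identityˡ ε)) (h ⊙ g ⊙ f))
      ≡⟨ cong (subst K e) (sym (⊙-substʳ (·-identityˡ ε) h (g ⊙ f))) ⟩
    h ◁ (g ◁ f) ∎
    where
      K = Kl ψ ω
      e = ·-identityˡ m

  η̇-◁ : ∀ {ψ φ} (f : Kl ψ φ ε) → η̇ ◁ f ≡ f
  η̇-◁ {ψ} {φ} f = trans (cong (λ p → subst (Kl ψ φ) p (η̇ ⊙ f)) (uip (·-identityˡ ε) (·-identityʳ ε))) (η̇-⊙ f)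

  id⊛-◁ : ∀ {ψ φ χ ω m} (g : Kl χ ω m) (f : Kl φ χ ε) →
          (id {ψ} ⊛ g) ◁ (id ⊛ f) ≡ id ⊛ (g ◁ f)
  id⊛-◁ {m = m} g f = begin
    subst _ (·-identityˡ m) ((id ⊛ g) ⊙ (id ⊛ f))  ≡⟨ cong (subst _ (·-identityˡ m)) (sym (⊛-⊙ id id g f)) ⟩
    subst _ (·-identityˡ m) ((id ∘ id) ⊛ (g ⊙ f))  ≡⟨ cong (λ z → subst _ (·-identityˡ m) (z ⊛ (g ⊙ f))) (identityˡ id) ⟩
    subst _ (·-identityˡ m) (id ⊛ (g ⊙ f))         ≡⟨ subst-id⊛ (·-identityˡ m) (g ⊙ f) ⟩
    id ⊛ (g ◁ f)                                   ∎
    where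
      subst-id⊛ : ∀ {ψ χ ω j k} (e : j ≡ k) (x : Kl χ ω j) →
                  subst (Kl (ψ ⊗₀ χ) (ψ ⊗₀ ω)) e (id ⊛ x) ≡ id ⊛ subst (Kl χ ω) e x
      subst-id⊛ refl x = refl

  record InjectionRetract {I : Set} (X : I → Obj) {W S : Obj}
           (κ : ∀ i → Kl (X i) W ε) (ι : ∀ i → Kl (X i) S ε) : Set ℓ' where
    field
      to      : Kl W S ε
      from    : Kl S W ε
      to-κ    : ∀ i → to ◁ κ i ≡ ι i
      from-ι  : ∀ i → from ◁ ι i ≡ κ i
      from◁to : from ◁ to ≡ η̇

  homogeneous-coproduct-retract :
    ∀ {I : Set} {X : I → Obj} {W S} {κ : ∀ i → Kl (X i) W ε} {ι : ∀ i → Kl (X i) S ε} →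
    IsHomogeneousCoproduct (KleisliGradedCategory M Ṫ) X S ι → InjectionRetract X κ ι →
    IsHomogeneousCoproduct (KleisliGradedCategory M Ṫ) X W κ
  homogeneous-coproduct-retract {κ = κ} {ι} hS r = record
    { copair        = λ f → S.copair f ◁ to
    ; copair-β      = λ f i → trans (◁-assoc _ to (κ i)) (trans (cong (S.copair f ◁_) (to-κ i)) (S.copair-β f i))
    ; copair-unique = λ h h' eq → ◁-injective h h' (λ i → cong (subst _ (·-identityˡ _)) (eq i))
    }
    where
      module S = IsHomogeneousCoproduct hS
      open InjectionRetract r
      ◁-injective : ∀ {Y m} (h h' : Kl _ Y m) → (∀ i → h ◁ κ i ≡ h' ◁ κ i) → h ≡ h'
      ◁-injective {m = m} h h' eq = begin
        h                ≡⟨ sym (◁-η̇ h) ⟩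
        h ◁ η̇            ≡⟨ cong (h ◁_) (sym from◁to) ⟩
        h ◁ (from ◁ to)  ≡⟨ sym (◁-assoc h from to) ⟩
        (h ◁ from) ◁ to  ≡⟨ cong (_◁ to) from-eq ⟩
        (h' ◁ from) ◁ to ≡⟨ ◁-assoc h' from to ⟩
        h' ◁ (from ◁ to) ≡⟨ cong (h' ◁_) from◁to ⟩
        h' ◁ η̇           ≡⟨ ◁-η̇ h' ⟩
        h'               ∎
        where
          via-κ : ∀ (k : Kl _ _ m) i → (k ◁ from) ◁ ι i ≡ k ◁ κ i
          via-κ k i = trans (◁-assoc k from (ι i)) (cong (k ◁_) (from-ι i))
          from-eq : h ◁ from ≡ h' ◁ from
          from-eq = S.copair-unique _ _ (λ i → subst-injective (·-identityˡ m)
                      (trans (via-κ h i) (trans (eq i) (sym (via-κ h' i)))))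

  homogeneous-coproducts-retract :
    ∀ {I : Set} {X : I → Obj} {W S} {κ : ∀ i → Kl (X i) W ε} {ι : ∀ i → Kl (X i) S ε} →
    IsHomogeneousCoproduct (KleisliGradedCategory M Ṫ) X W κ →
    IsHomogeneousCoproduct (KleisliGradedCategory M Ṫ) X S ι → InjectionRetract X κ ι
  homogeneous-coproducts-retract {κ = κ} {ι} hW hS = record
    { to      = W.copair ι
    ; from    = S.copair κ
    ; to-κ    = W.copair-β ι
    ; from-ι  = S.copair-β κ
    ; from◁to = W.copair-unique _ _ (λ i → subst-injective (·-identityˡ ε) (begin
        (S.copair κ ◁ W.copair ι) ◁ κ i  ≡⟨ ◁-assoc _ _ (κ i) ⟩
        S.copair κ ◁ (W.copair ι ◁ κ i)  ≡⟨ cong (S.copair κ ◁_) (W.copair-β ι i) ⟩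
        S.copair κ ◁ ι i                 ≡⟨ S.copair-β κ i ⟩
        κ i                              ≡⟨ sym (η̇-◁ (κ i)) ⟩
        η̇ ◁ κ i                          ∎))
    }
    where
      module W = IsHomogeneousCoproduct hW
      module S = IsHomogeneousCoproduct hS

  J-preserves-coproducts : ∀ {I : Set} {X : I → Obj} {Z} {ι : ∀ i → X i ⇒ Z} →
    IsCoproduct _⇒_ _∘_ X Z ι → IsHomogeneousCoproduct (KleisliGradedCategory M Ṫ) X Z (λ i → J (ι i))
  J-preserves-coproducts {ι = ι} isC = record
    { copair        = C.copair
    ; copair-β      = λ f i → trans (◁-J _ _) (C.copair-β f i)
    ; copair-unique = λ h h' eq → C.copair-unique h h' (λ i →
        trans (sym (◁-J h (ι i))) (trans (cong (subst _ (·-identityˡ _)) (eq i)) (◁-J h' (ι i))))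
    }
    where module C = IsCoproduct isC

  module _ (Pcop : DistributiveCountableCoproducts P PC) where
    open DistributiveCountableCoproducts Pcop

    id⊛-preserves-coproducts : ∀ {I : Set} (c : Countable I) (X : I → Obj) (W : Obj)
      (κ : ∀ i → Kl (X i) W ε) → IsHomogeneousCoproduct (KleisliGradedCategory M Ṫ) X W κ →
      (A : Obj) → IsHomogeneousCoproduct (KleisliGradedCategory M Ṫ) (λ i → A ⊗₀ X i) (A ⊗₀ W) (λ i → id ⊛ κ i)
    id⊛-preserves-coproducts c X W κ hW A =
      homogeneous-coproduct-retract (J-preserves-coproducts (distributive c X A)) (record
        { to      = id ⊛ to
        ; from    = id ⊛ from
        ; to-κ    = λ i → trans (id⊛-◁ to (κ i)) (trans (cong (id ⊛_) (to-κ i)) (sym (J-⊗ id (ι c X i))))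
        ; from-ι  = λ i → trans (cong (id ⊛ from ◁_) (J-⊗ id (ι c X i)))
                              (trans (id⊛-◁ from _) (cong (id ⊛_) (from-ι i)))
        ; from◁to = trans (id⊛-◁ from to) (trans (cong (id ⊛_) from◁to) ṡt-η)
        })
      where open InjectionRetract (homogeneous-coproducts-retract hW (J-preserves-coproducts (isCoproduct c X)))

    kleisli-hasHomogeneousCountableCoproducts : HasHomogeneousCountableCoproducts (KleisliGradedFreyd M Ṫ)
    kleisli-hasHomogeneousCountableCoproducts = record
      { base-coproducts        = Pcop
      ; homogeneous-coproducts = λ c X → ∐ c X , (λ i → J (ι c X i)) , J-preserves-coproducts (isCoproduct c X)
      ; I-preserves            = λ _ _ _ _ → J-preserves-coproducts
      ; id⊛-preserves          = id⊛-preserves-coproducts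
      }

module KleisliProperties {o ℓ} {V : Category o ℓ} {VC : Cartesian V} (T : StrongMonad V VC) where
  open Category V
  open StrongMonad T renaming (assoc to μ-assoc; identityˡ to μ-identityˡ; identityʳ to μ-identityʳ)
  open ≡-Reasoning

  infixr 9 _⊚_
  _⊚_ : ∀ {A B C} → B ⇒ T₀ C → A ⇒ T₀ B → A ⇒ T₀ C
  g ⊚ f = μ ∘ T₁ g ∘ f

  ⊚-assoc : ∀ {A B C D} (h : C ⇒ T₀ D) (g : B ⇒ T₀ C) (f : A ⇒ T₀ B) → (h ⊚ g) ⊚ f ≡ h ⊚ g ⊚ f
  ⊚-assoc h g f = begin
    μ ∘ T₁ (μ ∘ T₁ h ∘ g) ∘ f          ≡⟨ cong (λ z → μ ∘ z ∘ f) (trans (T-homomorphism _ _) (cong (T₁ μ ∘_) (T-homomorphism _ _))) ⟩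
    μ ∘ (T₁ μ ∘ T₁ (T₁ h) ∘ T₁ g) ∘ f  ≡⟨ trans (cong (μ ∘_) (assoc _ _ _)) (sym (assoc _ _ _)) ⟩
    (μ ∘ T₁ μ) ∘ (T₁ (T₁ h) ∘ T₁ g) ∘ f ≡⟨ cong (_∘ (T₁ (T₁ h) ∘ T₁ g) ∘ f) μ-assoc ⟩
    (μ ∘ μ) ∘ (T₁ (T₁ h) ∘ T₁ g) ∘ f   ≡⟨ trans (assoc _ _ _) (cong (μ ∘_) (trans (cong (μ ∘_) (assoc _ _ _)) (sym (assoc _ _ _)))) ⟩
    μ ∘ (μ ∘ T₁ (T₁ h)) ∘ T₁ g ∘ f     ≡⟨ cong (λ z → μ ∘ z ∘ T₁ g ∘ f) (sym (μ-natural h)) ⟩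
    μ ∘ (T₁ h ∘ μ) ∘ T₁ g ∘ f          ≡⟨ cong (μ ∘_) (assoc _ _ _) ⟩
    h ⊚ g ⊚ f                          ∎

  ⊚-η∘ : ∀ {A B C} (h : B ⇒ T₀ C) (j : A ⇒ B) → h ⊚ η ∘ j ≡ h ∘ j
  ⊚-η∘ h j = begin
    μ ∘ T₁ h ∘ η ∘ j     ≡⟨ cong (μ ∘_) (trans (sym (assoc _ _ _)) (trans (cong (_∘ j) (η-natural h)) (assoc _ _ _))) ⟩
    μ ∘ η ∘ h ∘ j        ≡⟨ trans (sym (assoc _ _ _)) (trans (cong (_∘ h ∘ j) μ-identityˡ) (identityˡ _)) ⟩
    h ∘ j                ∎

  ⊚-η : ∀ {A B} (h : A ⇒ T₀ B) → h ⊚ η ≡ h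
  ⊚-η h = trans (cong (h ⊚_) (sym (identityʳ η))) (trans (⊚-η∘ h id) (identityʳ h))

  η∘-preserves-coproducts : ∀ {I : Set} {X : I → Obj} {Z} {ι : ∀ i → X i ⇒ Z} →
    IsCoproduct _⇒_ _∘_ X Z ι → IsCoproduct (λ A B → A ⇒ T₀ B) _⊚_ X Z (λ i → η ∘ ι i)
  η∘-preserves-coproducts {ι = ι} isC = record
    { copair        = C.copair
    ; copair-β      = λ f i → trans (⊚-η∘ _ _) (C.copair-β f i)
    ; copair-unique = λ h h' eq → C.copair-unique h h' (λ i →
        trans (sym (⊚-η∘ h (ι i))) (trans (eq i) (⊚-η∘ h' (ι i))))
    }
    where module C = IsCoproduct isC

  kleisli-coproduct-retract : ∀ {I : Set} {X : I → Obj} {W S}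
    {κ : ∀ i → X i ⇒ T₀ W} {ι : ∀ i → X i ⇒ T₀ S} →
    IsCoproduct (λ A B → A ⇒ T₀ B) _⊚_ X S ι →
    (to : W ⇒ T₀ S) (from : S ⇒ T₀ W) →
    (∀ i → to ⊚ κ i ≡ ι i) → (∀ i → from ⊚ ι i ≡ κ i) → from ⊚ to ≡ η →
    IsCoproduct (λ A B → A ⇒ T₀ B) _⊚_ X W κ
  kleisli-coproduct-retract {W = W} {κ = κ} {ι} hS to from to-κ from-ι from⊚to = record
    { copair        = λ f → S.copair f ⊚ to
    ; copair-β      = λ f i → trans (⊚-assoc _ to (κ i)) (trans (cong (S.copair f ⊚_) (to-κ i)) (S.copair-β f i))
    ; copair-unique = ⊚-injective
    }
    where
      module S = IsCoproduct hS
      ⊚-injective : ∀ {Y} (h h' : W ⇒ T₀ Y) → (∀ i → h ⊚ κ i ≡ h' ⊚ κ i) → h ≡ h'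
      ⊚-injective h h' eq = begin
        h                ≡⟨ sym (⊚-η h) ⟩
        h ⊚ η            ≡⟨ cong (h ⊚_) (sym from⊚to) ⟩
        h ⊚ from ⊚ to    ≡⟨ sym (⊚-assoc h from to) ⟩
        (h ⊚ from) ⊚ to  ≡⟨ cong (_⊚ to) from-eq ⟩
        (h' ⊚ from) ⊚ to ≡⟨ ⊚-assoc h' from to ⟩
        h' ⊚ from ⊚ to   ≡⟨ cong (h' ⊚_) from⊚to ⟩
        h' ⊚ η           ≡⟨ ⊚-η h' ⟩
        h'               ∎
        where
          via-κ : ∀ {Y} (k : _ ⇒ T₀ Y) i → (k ⊚ from) ⊚ ι i ≡ k ⊚ κ i
          via-κ k i = trans (⊚-assoc k from (ι i)) (cong (k ⊚_) (from-ι i))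
          from-eq : h ⊚ from ≡ h' ⊚ from
          from-eq = S.copair-unique _ _ (λ i → trans (via-κ h i) (trans (eq i) (sym (via-κ h' i))))

module KleisliComparison (M : PreorderedMonoid) {o ℓ o' ℓ'}
         {V : Category o ℓ} {P : Category o' ℓ'}
         {VC : Cartesian V} {PC : Cartesian P} {p : Functor P V}
         {pres : StrictlyPreservesProducts VC PC p} {T : StrongMonad V VC}
         (Ṫ : GradedLifting M pres T) where
  open PreorderedMonoid M
  private
    module V = Category V
    module VC = Cartesian VC
  open Category P
  open Cartesian PC
  open CastProperties V
  open CartesianProperties V VC using (cast-⊗₁ʳ)
  open ProductPreservation pres
  open KleisliGradedFreydProperties M Ṫ
  open KleisliProperties T
  open Functor p
  open GradedLifting Ṫ
  open StrongMonad T using (T₀; T₁; η; μ; st)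
  open StrictlyPreservesProducts pres
  open ≡-Reasoning

  T₁-cast : ∀ {A A' B B'} (a : A ≡ A') (b : B ≡ B') (h : A V.⇒ B) →
            T₁ (V.cast a b h) ≡ V.cast (cong T₀ a) (cong T₀ b) (T₁ h)
  T₁-cast refl refl h = refl

  q-⊙ : ∀ {ψ φ χ m n} (g : Kl φ χ n) (f : Kl ψ φ m) → q M Ṫ (g ⊙ f) ≡ q M Ṫ g ⊚ q M Ṫ f
  q-⊙ {ψ} {φ} {χ} {m} {n} g f = begin
      V.cast refl (lift-obj (m · n) χ) (F₁ (μ̇ ∘ Ṫ₁ m g ∘ f))
        ≡⟨ cong (V.cast refl (lift-obj (m · n) χ)) (trans (homomorphism _ _) (cong (F₁ μ̇ V.∘_) (homomorphism _ _))) ⟩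
      V.cast refl (lift-obj (m · n) χ) (F₁ μ̇ V.∘ F₁ (Ṫ₁ m g) V.∘ F₁ f)
        ≡⟨ cast-∘ refl TTχ (lift-obj (m · n) χ) _ _ ⟩
      V.cast TTχ (lift-obj (m · n) χ) (F₁ μ̇) V.∘ V.cast refl TTχ (F₁ (Ṫ₁ m g) V.∘ F₁ f)
        ≡⟨ cong₂ V._∘_ lift-μ (cast-∘ refl (lift-obj m φ) TTχ _ _) ⟩
      μ V.∘ V.cast (lift-obj m φ) TTχ (F₁ (Ṫ₁ m g)) V.∘ q M Ṫ f
        ≡⟨ cong (λ z → μ V.∘ z V.∘ q M Ṫ f) (begin
            V.cast (lift-obj m φ) TTχ (F₁ (Ṫ₁ m g))
              ≡⟨ cast-irrelevant _ (trans (lift-obj m φ) refl) _ _ _ ⟩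
            V.cast (trans (lift-obj m φ) refl) TTχ (F₁ (Ṫ₁ m g))
              ≡⟨ sym (cast-cast (lift-obj m φ) (lift-obj m (Ṫ₀ n χ)) refl (cong T₀ (lift-obj n χ)) _) ⟩
            V.cast refl (cong T₀ (lift-obj n χ)) (V.cast (lift-obj m φ) (lift-obj m (Ṫ₀ n χ)) (F₁ (Ṫ₁ m g)))
              ≡⟨ cong (V.cast refl (cong T₀ (lift-obj n χ))) (lift-hom m g) ⟩
            V.cast refl (cong T₀ (lift-obj n χ)) (T₁ (F₁ g))
              ≡⟨ sym (T₁-cast refl (lift-obj n χ) _) ⟩
            T₁ (q M Ṫ g) ∎) ⟩
      q M Ṫ g ⊚ q M Ṫ f ∎
    where TTχ = trans (lift-obj m (Ṫ₀ n χ)) (cong T₀ (lift-obj n χ))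

  q-subst : ∀ {ψ φ j k} (e : j ≡ k) (f : Kl ψ φ j) → q M Ṫ (subst (Kl ψ φ) e f) ≡ q M Ṫ f
  q-subst refl f = refl

  q-◁ : ∀ {ψ φ χ m} (h : Kl φ χ m) (f : Kl ψ φ ε) → q M Ṫ (h ◁ f) ≡ q M Ṫ h ⊚ q M Ṫ f
  q-◁ h f = trans (q-subst _ _) (q-⊙ h f)

  q-up : ∀ {ψ φ m n} (a : m ≤ n) (f : Kl ψ φ m) → q M Ṫ (Ṫ≤ a ∘ f) ≡ q M Ṫ f
  q-up {φ = φ} {m} {n} a f = begin
      V.cast refl (lift-obj n φ) (F₁ (Ṫ≤ a ∘ f))               ≡⟨ cong (V.cast refl (lift-obj n φ)) (homomorphism _ _) ⟩
      V.cast refl (lift-obj n φ) (F₁ (Ṫ≤ a) V.∘ F₁ f)          ≡⟨ cast-∘ refl (lift-obj m φ) (lift-obj n φ) _ _ ⟩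
      V.cast (lift-obj m φ) (lift-obj n φ) (F₁ (Ṫ≤ a)) V.∘ q M Ṫ f ≡⟨ cong (V._∘ q M Ṫ f) (lift-≤ a) ⟩
      V.id V.∘ q M Ṫ f                                          ≡⟨ V.identityˡ _ ⟩
      q M Ṫ f ∎

  q-J : ∀ {ψ φ} (f : ψ ⇒ φ) → q M Ṫ (J f) ≡ η V.∘ F₁ f
  q-J {φ = φ} f = trans (cong (V.cast refl (lift-obj ε φ)) (homomorphism _ _))
                        (trans (cast-∘ refl refl (lift-obj ε φ) _ _) (cong (V._∘ F₁ f) lift-η))

  q-⊛ : ∀ {ψ φ χ ω m} (f : ψ ⇒ φ) (g : Kl χ ω m) →
        subst₂ (λ A B → A V.⇒ T₀ B) (⊗-obj ψ χ) (⊗-obj φ ω) (q M Ṫ (f ⊛ g)) ≡ st V.∘ (F₁ f VC.⊗₁ q M Ṫ g)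
  q-⊛ {ψ} {φ} {χ} {ω} {m} f g = begin
      subst₂ (λ A B → A V.⇒ T₀ B) (⊗-obj ψ χ) (⊗-obj φ ω) (q M Ṫ (f ⊛ g))
        ≡⟨ subst₂-T₀ (⊗-obj ψ χ) (⊗-obj φ ω) _ ⟩
      V.cast (⊗-obj ψ χ) (cong T₀ (⊗-obj φ ω)) (V.cast refl (lift-obj m (φ ⊗₀ ω)) (F₁ (ṡt ∘ (f ⊗₁ g))))
        ≡⟨ cast-cast refl (lift-obj m (φ ⊗₀ ω)) (⊗-obj ψ χ) (cong T₀ (⊗-obj φ ω)) _ ⟩
      V.cast (trans refl (⊗-obj ψ χ)) T⊗ (F₁ (ṡt ∘ (f ⊗₁ g)))
        ≡⟨ cong (V.cast (trans refl (⊗-obj ψ χ)) T⊗) (homomorphism _ _) ⟩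
      V.cast (trans refl (⊗-obj ψ χ)) T⊗ (F₁ ṡt V.∘ F₁ (f ⊗₁ g))
        ≡⟨ cast-∘ (⊗-obj ψ χ) ⊗T T⊗ _ _ ⟩
      V.cast ⊗T T⊗ (F₁ ṡt) V.∘ V.cast (⊗-obj ψ χ) ⊗T (F₁ (f ⊗₁ g))
        ≡⟨ cong₂ V._∘_ lift-st (begin
            V.cast (⊗-obj ψ χ) ⊗T (F₁ (f ⊗₁ g))
              ≡⟨ cast-irrelevant _ (trans (⊗-obj ψ χ) refl) _ _ _ ⟩
            V.cast (trans (⊗-obj ψ χ) refl) ⊗T (F₁ (f ⊗₁ g))
              ≡⟨ sym (cast-cast (⊗-obj ψ χ) (⊗-obj φ (Ṫ₀ m ω)) refl (cong (F₀ φ VC.⊗₀_) (lift-obj m ω)) _) ⟩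
            V.cast refl (cong (F₀ φ VC.⊗₀_) (lift-obj m ω)) (V.cast (⊗-obj ψ χ) (⊗-obj φ (Ṫ₀ m ω)) (F₁ (f ⊗₁ g)))
              ≡⟨ cong (V.cast refl (cong (F₀ φ VC.⊗₀_) (lift-obj m ω))) (p-⊗₁ f g) ⟩
            V.cast refl (cong (F₀ φ VC.⊗₀_) (lift-obj m ω)) (F₁ f VC.⊗₁ F₁ g)
              ≡⟨ cast-⊗₁ʳ (F₁ f) (lift-obj m ω) (F₁ g) ⟩
            F₁ f VC.⊗₁ q M Ṫ g ∎) ⟩
      st V.∘ (F₁ f VC.⊗₁ q M Ṫ g) ∎
    where
      ⊗T = trans (⊗-obj φ (Ṫ₀ m ω)) (cong (F₀ φ VC.⊗₀_) (lift-obj m ω))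
      T⊗ = trans (lift-obj m (φ ⊗₀ ω)) (cong T₀ (⊗-obj φ ω))
      subst₂-T₀ : ∀ {A A' B B'} (a : A ≡ A') (b : B ≡ B') (h : A V.⇒ T₀ B) →
                  subst₂ (λ X Y → X V.⇒ T₀ Y) a b h ≡ V.cast a (cong T₀ b) h
      subst₂-T₀ refl refl h = refl

  module _ (Pcop : DistributiveCountableCoproducts P PC)
           (p-preserves-coproducts : ∀ {I : Set} (c : Countable I) (X : I → Obj) →
              IsCoproduct V._⇒_ V._∘_ (λ i → F₀ (X i)) (F₀ (DistributiveCountableCoproducts.∐ Pcop c X))
                          (λ i → F₁ (DistributiveCountableCoproducts.ι Pcop c X i))) where
    open DistributiveCountableCoproducts Pcop

    q-preserves-coproducts : ∀ {I : Set} → Countable I → (X : I → Obj) (W : Obj)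
      (κ : ∀ i → Kl (X i) W ε) → IsHomogeneousCoproduct (KleisliGradedCategory M Ṫ) X W κ →
      IsCoproduct (λ A B → A V.⇒ T₀ B) _⊚_ (λ i → F₀ (X i)) (F₀ W) (λ i → q M Ṫ (κ i))
    q-preserves-coproducts c X W κ hW = kleisli-coproduct-retract
      (η∘-preserves-coproducts (p-preserves-coproducts c X)) (q M Ṫ to) (q M Ṫ from)
      (λ i → trans (sym (q-◁ to (κ i))) (trans (cong (q M Ṫ) (to-κ i)) (q-J (ι c X i))))
      (λ i → trans (cong (q M Ṫ from ⊚_) (sym (q-J (ι c X i))))
               (trans (sym (q-◁ from _)) (cong (q M Ṫ) (from-ι i))))
      (trans (sym (q-◁ from to)) (trans (cong (q M Ṫ) from◁to) lift-η))
      where open InjectionRetract (homogeneous-coproducts-retract hW (J-preserves-coproducts (isCoproduct c X)))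

  module _ (fib : Fibred.FibrationForAssertionLogic p VC) where
    open Fibred.FibrationForAssertionLogic fib using (⊥; ⊥-min)
    open FibrationProperties fib pres using (p-faithful; ≤reindex⇒≤[]; ⟦_⟧)

    -- ⊥_X lies below the reindexing of every predicate, so every u : X → p φ lifts to ⊥_X.
    q-⊥-bijective : ∀ X φ m → Bijective _≡_ _≡_ (q M Ṫ {proj₁ (⊥ X)} {φ} {m})
    q-⊥-bijective X φ m =
      (λ {f} {g} e → p-faithful f g (cast-injectiveʳ (lift-obj m φ) e)) ,
      (λ v → proj₁ (lift-of v) , λ {z} z≡ → trans (cong (q M Ṫ) z≡) (q-lift-of v))
      where
        e⊥ = proj₂ (⊥ X)
        lift-of : (v : F₀ (proj₁ (⊥ X)) V.⇒ T₀ (F₀ φ)) → _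
        lift-of v = ≤reindex⇒≤[] {u = V.cast e⊥ (sym (lift-obj m φ)) v} {φ = ⟦ Ṫ₀ m φ ⟧} (⊥-min _)
        q-lift-of : ∀ v → q M Ṫ (proj₁ (lift-of v)) ≡ v
        q-lift-of v = begin
          V.cast refl (lift-obj m φ) (F₁ (proj₁ (lift-of v)))
            ≡⟨ cong (V.cast refl (lift-obj m φ)) (cast-move e⊥ refl (proj₂ (lift-of v))) ⟩
          V.cast refl (lift-obj m φ) (V.cast (sym e⊥) refl (V.cast e⊥ (sym (lift-obj m φ)) v))
            ≡⟨ trans (cong (V.cast refl (lift-obj m φ)) (cast-cast e⊥ _ (sym e⊥) refl v))
                     (cast-cast _ (trans (sym (lift-obj m φ)) refl) refl (lift-obj m φ) v) ⟩
          V.cast (trans (trans e⊥ (sym e⊥)) refl) (trans (trans (sym (lift-obj m φ)) refl) (lift-obj m φ)) v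
            ≡⟨ cast-trivial _ _ v ⟩
          v ∎

mainTheorem7 : ∀ {o ℓ o' ℓ' : Level}
    (M : PreorderedMonoid)
    (V : Category o ℓ) (VC : Cartesian V)
    (Vcop : DistributiveCountableCoproducts V VC)
    (P : Category o' ℓ') (PC : Cartesian P)
    (p : Functor P V)
    (fib : Fibred.FibrationForAssertionLogic p VC)
    (pres : StrictlyPreservesProducts VC PC p)
    (T : StrongMonad V VC)
    (Ṫ : GradedLifting M pres T) →
    IsLogicalStructure M fib pres (KleisliFreyd T) (KleisliGradedFreyd M Ṫ) (q M Ṫ)
mainTheorem7 M V VC Vcop P PC p fib pres T Ṫ = record
  { isGradedFreyd                     = kleisli-isGradedFreyd
  ; hasHomogeneousCountableCoproducts = kleisli-hasHomogeneousCountableCoproducts Pcop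
  ; q-id                              = GradedLifting.lift-η Ṫ
  ; q-comp                            = q-⊙
  ; q-up                              = q-up
  ; q-I                               = q-J
  ; q-⊛                               = q-⊛
  ; q-coproducts                      = q-preserves-coproducts Pcop (Coproduct.p-isCoproduct Vcop)
  ; q-⊥-bijective                     = q-⊥-bijective fib
  }
  where
    open KleisliGradedFreydProperties M Ṫ
    open KleisliComparison M Ṫ
    open FibrationProperties fib pres using (module Coproduct; distributiveCountableCoproducts)
    Pcop = distributiveCountableCoproducts Vcop
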